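{- Let $\Psi\in\{\mathfrak F,\mathfrak B\}$, let $\alpha,\beta$ satisfy $2<\alpha\le 3$ and $4\alpha-\beta=6$, and let $G\in\mathcal G(\Psi,\alpha,\beta)$. Then $G$ has no vertices of degree less than $4$, and for every vertex $v$ of degree $4$ the subgraph of $G$ induced on the neighborhood $N(v)$ is isomorphic to $T_0$ or $T_1$.
   Context: All graphs are finite and simple. $|G|$ is the number of vertices, $e(G)$ the number of edges, $G|_X$ the subgraph induced on $X$. $q_{\alpha,\beta}(G)=\alpha|G|-e(G)-\beta$. $\mathfrak F$ is the class of forests and $\mathfrak B$ the class of bipartite graphs. A vertex cut is a vertex set whose removal disconnects the graph; a $\Psi$-cut of $G$ is a vertex cut $M$ with $G|_M\in\Psi$. $\mathcal G(\Psi,\alpha,\beta)$ is the set of graphs $G$ such that $|G|\ge4$, $q_{\alpha,\beta}(G)>0$, $G$ has no $\Psi$-cut, and $G$ has the smallest number of vertices among all graphs with these three properties. $T_0$ is the 4-vertex graph consisting of a triangle and an isolated vertex; $T_1$ is the 4-vertex graph consisting of a triangle plus a fourth vertex adjacent to exactly one triangle vertex.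
   Formalization: The parameters α and β range over the rationals instead of the reals. -}

module Defs where

open import Data.Nat using (ℕ; zero; suc; _+_; _<ᵇ_)
open import Data.Bool using (Bool; true; false; if_then_else_; _∧_)
open import Data.Fin using (Fin; zero; suc; toℕ; inject₁; fromℕ)
open import Data.Fin.Subset using (Subset; _∈_; _∉_)
open import Data.Vec using (tabulate)
open import Data.Product using (Σ; ∃; _×_; _,_)
open import Data.Integer using (+_)
open import Data.Rational using (ℚ; _/_; _*_; _-_; _<_; 0ℚ)
open import Relation.Nullary using (¬_)
open import Relation.Binary.PropositionalEquality using (_≡_; _≢_; refl)
open import Function.Definitions using (Injective)

record Graph : Set where
  field
    n      : ℕ
    adj    : Fin n → Fin n → Bool
    sym    : ∀ i j → adj i j ≡ adj j i
    irrefl : ∀ i → adj i i ≡ false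
open Graph public

sumF : ∀ {k} → (Fin k → ℕ) → ℕ
sumF {zero}  f = 0
sumF {suc k} f = f zero + sumF (λ i → f (suc i))

∣_∣ᵍ : Graph → ℕ
∣ G ∣ᵍ = n G

e : Graph → ℕ
e G = sumF (λ i → sumF (λ j → if (toℕ i <ᵇ toℕ j) ∧ adj G i j then 1 else 0))

deg : (G : Graph) → Fin (n G) → ℕ
deg G v = sumF (λ u → if adj G v u then 1 else 0)

N : (G : Graph) → Fin (n G) → Subset (n G)
N G v = tabulate (adj G v)

q : ℚ → ℚ → Graph → ℚ
q α β G = α * (+ ∣ G ∣ᵍ / 1) - (+ e G / 1) - β

-- Reachability in G - M (both endpoints and all intermediate vertices outside M)
data Reach (G : Graph) (M : Subset (n G)) : Fin (n G) → Fin (n G) → Set where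
  here : ∀ {u} → u ∉ M → Reach G M u u
  step : ∀ {u w v} → u ∉ M → adj G u w ≡ true → Reach G M w v → Reach G M u v

VertexCut : (G : Graph) → Subset (n G) → Set
VertexCut G M = Σ (Fin (n G)) λ u → Σ (Fin (n G)) λ v →
  u ∉ M × v ∉ M × ¬ Reach G M u v

CycleIn : (G : Graph) → Subset (n G) → Set
CycleIn G X = Σ ℕ λ m → Σ (Fin (suc (suc (suc m))) → Fin (n G)) λ f →
  Injective _≡_ _≡_ f ×
  (∀ i → f i ∈ X) ×
  (∀ (i : Fin (suc (suc m))) → adj G (f (inject₁ i)) (f (suc i)) ≡ true) ×
  (adj G (f (fromℕ (suc (suc m)))) (f zero) ≡ true)

IsForestOn : (G : Graph) → Subset (n G) → Set
IsForestOn G X = ¬ CycleIn G X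

IsBipartiteOn : (G : Graph) → Subset (n G) → Set
IsBipartiteOn G X = Σ (Fin (n G) → Bool) λ c →
  ∀ u v → u ∈ X → v ∈ X → adj G u v ≡ true → c u ≢ c v

data Class : Set where
  𝔉 𝔅 : Class

InClassOn : Class → (G : Graph) → Subset (n G) → Set
InClassOn 𝔉 G X = IsForestOn G X
InClassOn 𝔅 G X = IsBipartiteOn G X

ΨCut : Class → (G : Graph) → Subset (n G) → Set
ΨCut Ψ G M = VertexCut G M × InClassOn Ψ G M

Good : Class → ℚ → ℚ → Graph → Set
Good Ψ α β G = (4 Data.Nat.≤ ∣ G ∣ᵍ) × (0ℚ < q α β G) × (¬ Σ (Subset (n G)) (ΨCut Ψ G))

In𝒢 : Class → ℚ → ℚ → Graph → Set
In𝒢 Ψ α β G = Good Ψ α β G × (∀ H → Good Ψ α β H → ∣ G ∣ᵍ Data.Nat.≤ ∣ H ∣ᵍ)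

InducedIso : (T G : Graph) → Subset (n G) → Set
InducedIso T G X = Σ (Fin (n T) → Fin (n G)) λ f →
  Injective _≡_ _≡_ f ×
  (∀ i → f i ∈ X) ×
  (∀ x → x ∈ X → Σ (Fin (n T)) λ i → f i ≡ x) ×
  (∀ i j → adj G (f i) (f j) ≡ adj T i j)

-- T0: triangle {0,1,2} plus isolated vertex 3
adjT0 : Fin 4 → Fin 4 → Bool
adjT0 zero (suc zero) = true
adjT0 zero (suc (suc zero)) = true
adjT0 (suc zero) zero = true
adjT0 (suc zero) (suc (suc zero)) = true
adjT0 (suc (suc zero)) zero = true
adjT0 (suc (suc zero)) (suc zero) = true
adjT0 _ _ = false

-- T1: triangle {0,1,2} plus vertex 3 adjacent to 0 only
adjT1 : Fin 4 → Fin 4 → Bool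
adjT1 zero (suc (suc (suc zero))) = true
adjT1 (suc (suc (suc zero))) zero = true
adjT1 i j = adjT0 i j

symT0 : ∀ i j → adjT0 i j ≡ adjT0 j i
symT0 zero zero = refl
symT0 zero (suc zero) = refl
symT0 zero (suc (suc zero)) = refl
symT0 zero (suc (suc (suc zero))) = refl
symT0 (suc zero) zero = refl
symT0 (suc zero) (suc zero) = refl
symT0 (suc zero) (suc (suc zero)) = refl
symT0 (suc zero) (suc (suc (suc zero))) = refl
symT0 (suc (suc zero)) zero = refl
symT0 (suc (suc zero)) (suc zero) = refl
symT0 (suc (suc zero)) (suc (suc zero)) = refl
symT0 (suc (suc zero)) (suc (suc (suc zero))) = refl
symT0 (suc (suc (suc zero))) zero = refl
symT0 (suc (suc (suc zero))) (suc zero) = refl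
symT0 (suc (suc (suc zero))) (suc (suc zero)) = refl
symT0 (suc (suc (suc zero))) (suc (suc (suc zero))) = refl

symT1 : ∀ i j → adjT1 i j ≡ adjT1 j i
symT1 zero zero = refl
symT1 zero (suc zero) = refl
symT1 zero (suc (suc zero)) = refl
symT1 zero (suc (suc (suc zero))) = refl
symT1 (suc zero) zero = refl
symT1 (suc zero) (suc zero) = refl
symT1 (suc zero) (suc (suc zero)) = refl
symT1 (suc zero) (suc (suc (suc zero))) = refl
symT1 (suc (suc zero)) zero = refl
symT1 (suc (suc zero)) (suc zero) = refl
symT1 (suc (suc zero)) (suc (suc zero)) = refl
symT1 (suc (suc zero)) (suc (suc (suc zero))) = refl
symT1 (suc (suc (suc zero))) zero = refl
symT1 (suc (suc (suc zero))) (suc zero) = refl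
symT1 (suc (suc (suc zero))) (suc (suc zero)) = refl
symT1 (suc (suc (suc zero))) (suc (suc (suc zero))) = refl

irrT0 : ∀ i → adjT0 i i ≡ false
irrT0 zero = refl
irrT0 (suc zero) = refl
irrT0 (suc (suc zero)) = refl
irrT0 (suc (suc (suc zero))) = refl

irrT1 : ∀ i → adjT1 i i ≡ false
irrT1 zero = refl
irrT1 (suc zero) = refl
irrT1 (suc (suc zero)) = refl
irrT1 (suc (suc (suc zero))) = refl

T₀ : Graph
T₀ = record { n = 4 ; adj = adjT0 ; sym = symT0 ; irrefl = irrT0 }

T₁ : Graph
T₁ = record { n = 4 ; adj = adjT1 ; sym = symT1 ; irrefl = irrT1 }

module Submission where

-- Let G be a minimal graph with q > 0 and no Ψ-cut. If a vertex v has a non-neighbour, N(v) separates v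
-- from it, so N(v) does not induce a graph of Ψ. If instead N(v) becomes a clique after adding a set E of
-- at most deg v − 3 edges, then G′ = G − v + E still has q > 0 (as α ≤ 3) and fewer vertices, and every
-- Ψ-cut of G′ lifts to one of G, since the neighbours of v stay connected in G′; so G′ contradicts the
-- minimality of G. The same lifting works for Ψ = 𝔉 when N(v) is a 4-cycle abcd and E = {ac}, after adding
-- v to a cut containing a and c but not b and d. As K₄ and K₅ have q ≤ 0, |G| ≥ 6, so every vertex of
-- degree at most 4 has a non-neighbour. Running through all graphs on at most four vertices then leaves
-- no vertex of degree below 4, and only T₀ and T₁ as neighbourhoods of vertices of degree 4.

open import Defs
open import Data.Nat as ℕ using (ℕ; suc)
open import Data.Integer using (+_)
open import Data.Rational using (ℚ; _/_; _*_; _-_; _<_; 0ℚ)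
open import Data.Rational using () renaming (_≤_ to _≤ℚ_)
open import Relation.Binary.PropositionalEquality as ≡ using (_≡_; refl; cong; cong₂; subst; module ≡-Reasoning)
open import Relation.Nullary using (¬_)

-- Arithmetic of q

module _ where
  import Data.Integer as ℤ
  import Data.Integer.Properties as ℤ
  import Data.Nat.Coprimality as Coprime
  open import Data.Rational
  open import Data.Rational.Properties
  open import Data.Rational.Solver using (module +-*-Solver)

  toℚ : ℕ → ℚ
  toℚ a = + a / 1

  toℚ≡mkℚ : ∀ a → toℚ a ≡ mkℚ (+ a) 0 (Coprime.sym (Coprime.1-coprimeTo a))
  toℚ≡mkℚ a = normalize-coprime (Coprime.sym (Coprime.1-coprimeTo a))

  toℚ-+ : ∀ a b → toℚ (a ℕ.+ b) ≡ toℚ a + toℚ b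
  toℚ-+ a b rewrite toℚ≡mkℚ a | toℚ≡mkℚ b =
    /-cong (cong₂ ℤ._+_ (≡.sym (ℤ.*-identityʳ (+ a))) (≡.sym (ℤ.*-identityʳ (+ b)))) refl

  toℚ-mono-≤ : ∀ {a b} → a ℕ.≤ b → toℚ a ≤ toℚ b
  toℚ-mono-≤ {a} {b} a≤b rewrite toℚ≡mkℚ a | toℚ≡mkℚ b =
    *≤* (ℤ.*-monoʳ-≤-nonNeg (+ 1) (ℤ.+≤+ a≤b))

  p≤q⇒p-q≤0 : ∀ {p q} → p ≤ q → p - q ≤ 0ℚ
  p≤q⇒p-q≤0 {p} {q} p≤q = subst (p - q ≤_) (+-inverseʳ q) (+-monoˡ-≤ (- q) p≤q)

  -- α ≤ 3 makes q non-decreasing when a vertex and at least three edges disappear.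
  q-pos-deletion : ∀ {α β} (G G′ : Graph) → α ≤ toℚ 3 → suc (n G′) ≡ n G → e G′ ℕ.+ 3 ℕ.≤ e G →
                   0ℚ < q α β G → 0ℚ < q α β G′
  q-pos-deletion {α} {β} G G′ α≤3 refl e′+3≤e 0<q = <-≤-trans 0<q (begin
    q α β G                ≡⟨ decompose ⟩
    q α β G′ + loss        ≤⟨ +-monoʳ-≤ (q α β G′) loss≤0 ⟩
    q α β G′ + 0ℚ          ≡⟨ +-identityʳ (q α β G′) ⟩
    q α β G′               ∎)
    where
    open ≤-Reasoning
    open +-*-Solver
    loss : ℚ
    loss = (α - toℚ 3) + (toℚ (e G′ ℕ.+ 3) - toℚ (e G))
    loss≤0 : loss ≤ 0ℚ
    loss≤0 = subst (loss ≤_) (+-identityʳ 0ℚ)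
               (+-mono-≤ (p≤q⇒p-q≤0 α≤3) (p≤q⇒p-q≤0 (toℚ-mono-≤ e′+3≤e)))
    decompose : q α β G ≡ q α β G′ + loss
    decompose = ≡.trans (cong (λ m → α * m - toℚ (e G) - β) (toℚ-+ 1 (n G′))) (≡.trans
      (solve 6 (λ a b k x x′ t → a :* (con 1ℚ :+ k) :- x :- b := (a :* k :- x′ :- b) :+ ((a :- t) :+ ((x′ :+ t) :- x)))
        refl α β (toℚ (n G′)) (toℚ (e G)) (toℚ (e G′)) (toℚ 3))
      (cong (λ m → q α β G′ + ((α - toℚ 3) + (m - toℚ (e G)))) (≡.sym (toℚ-+ (e G′) 3))))

  q-K₄-nonpos : ∀ {α β} (G : Graph) → toℚ 4 * α - β ≡ toℚ 6 → n G ≡ 4 → e G ≡ 6 → ¬ 0ℚ < q α β G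
  q-K₄-nonpos {α} {β} G 4α-β≡6 n≡4 e≡6 0<q = <-irrefl refl (subst (0ℚ <_) q≡0 0<q)
    where
    open ≡-Reasoning
    open +-*-Solver
    q≡0 : q α β G ≡ 0ℚ
    q≡0 = begin
      q α β G                 ≡⟨ cong₂ (λ x y → α * toℚ x - toℚ y - β) n≡4 e≡6 ⟩
      α * toℚ 4 - toℚ 6 - β   ≡⟨ solve 4 (λ a b f s → a :* f :- s :- b := (f :* a :- b) :- s) refl α β (toℚ 4) (toℚ 6) ⟩
      toℚ 4 * α - β - toℚ 6   ≡⟨ cong (_- toℚ 6) 4α-β≡6 ⟩
      toℚ 6 - toℚ 6           ≡⟨ +-inverseʳ (toℚ 6) ⟩
      0ℚ                      ∎

  q-K₅-nonpos : ∀ {α β} (G : Graph) → α ≤ toℚ 3 → toℚ 4 * α - β ≡ toℚ 6 → n G ≡ 5 → e G ≡ 10 → ¬ 0ℚ < q α β G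
  q-K₅-nonpos {α} {β} G α≤3 4α-β≡6 n≡5 e≡10 0<q = <-asym 0<q (begin-strict
    q α β G                                           ≡⟨ cong₂ (λ x y → α * toℚ x - toℚ y - β) n≡5 e≡10 ⟩
    α * toℚ (4 ℕ.+ 1) - toℚ (6 ℕ.+ 4) - β             ≡⟨ cong₂ (λ x y → α * x - y - β) (toℚ-+ 4 1) (toℚ-+ 6 4) ⟩
    α * (toℚ 4 + 1ℚ) - (toℚ 6 + toℚ 4) - β            ≡⟨ solve 4 (λ a b f s → a :* (f :+ con 1ℚ) :- (s :+ f) :- b := (f :* a :- b :- s) :+ (a :- f))
                                                           refl α β (toℚ 4) (toℚ 6) ⟩
    (toℚ 4 * α - β - toℚ 6) + (α - toℚ 4)             ≡⟨ cong (λ x → (x - toℚ 6) + (α - toℚ 4)) 4α-β≡6 ⟩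
    (toℚ 6 - toℚ 6) + (α - toℚ 4)                     ≡⟨ cong (_+ (α - toℚ 4)) (+-inverseʳ (toℚ 6)) ⟩
    0ℚ + (α - toℚ 4)                                  ≡⟨ +-identityˡ (α - toℚ 4) ⟩
    α - toℚ 4                                         <⟨ +-monoˡ-< (- toℚ 4) (≤-<-trans α≤3 3<4) ⟩
    toℚ 4 - toℚ 4                                     ≡⟨ +-inverseʳ (toℚ 4) ⟩
    0ℚ                                                ∎)
    where
    open ≤-Reasoning
    open +-*-Solver
    3<4 : toℚ 3 < toℚ 4
    3<4 = *<* (ℤ.+<+ (ℕ.s≤s (ℕ.s≤s (ℕ.s≤s (ℕ.s≤s ℕ.z≤n)))))

open import Data.Bool using (Bool; true; false; if_then_else_; _∧_; _∨_; T; T?)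
import Data.Bool.Properties as Bool
open import Data.Empty using (⊥; ⊥-elim)
open import Data.Fin using (Fin; zero; suc; toℕ; punchIn; punchOut; inject₁; fromℕ; lower₁)
open import Data.Fin.Patterns using (0F; 1F; 2F; 3F)
open import Data.Fin.Subset using (Subset; _∈_; _∉_)
open import Data.Fin.Subset.Properties using (_∈?_; anySubset?)
open import Data.Vec using (lookup; []; _∷_; insertAt)
import Data.Vec.Properties as Vec
import Data.Fin.Properties as Fin
open import Data.Fin.Properties using (any?; all?)
open import Data.Nat using (zero; _+_; _≤_; z≤n; s≤s; _<ᵇ_)
import Data.Nat.Properties as ℕ
open import Data.Nat.Combinatorics using (_C_; nC1≡n; nCk+nC[k+1]≡[n+1]C[k+1])
open import Algebra.Properties.CommutativeSemigroup ℕ.+-commutativeSemigroup using (interchange; x∙yz≈y∙xz)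
open import Data.Product using (Σ; ∃; ∃₂; _×_; _,_; proj₁; proj₂)
open import Data.Sum using (_⊎_; inj₁; inj₂)
import Data.Sum as Sum
open import Function using (id; _∘_; _$_; mk⇔)
open import Function.Definitions using (Injective)
open import Relation.Binary using (tri<; tri≈; tri>)
open import Relation.Binary.PropositionalEquality using (_≢_; _≗_; trans; subst₂)
open import Relation.Nullary using (Dec; does; yes; no; contradiction; ¬?; _×-dec_; _⊎-dec_; _→-dec_)
open import Relation.Nullary.Decidable using (dec-true; dec-false; does-⇔; dec⇒maybe; from-yes; map′; toSum)
open import Data.Maybe using (Maybe; nothing; _<∣>_; is-just; to-witness-T)
import Data.Maybe as Maybe

-- Counting and edges

sumF-cong : ∀ {m} {f g : Fin m → ℕ} → f ≗ g → sumF f ≡ sumF g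
sumF-cong {zero}  f≗g = refl
sumF-cong {suc m} f≗g = cong₂ _+_ (f≗g zero) (sumF-cong (f≗g ∘ suc))

sumF-mono-≤ : ∀ {m} {f g : Fin m → ℕ} → (∀ i → f i ≤ g i) → sumF f ≤ sumF g
sumF-mono-≤ {zero}  f≤g = z≤n
sumF-mono-≤ {suc m} f≤g = ℕ.+-mono-≤ (f≤g zero) (sumF-mono-≤ (f≤g ∘ suc))

sumF-distrib-+ : ∀ {m} (f g : Fin m → ℕ) → sumF (λ i → f i + g i) ≡ sumF f + sumF g
sumF-distrib-+ {zero}  f g = refl
sumF-distrib-+ {suc m} f g = begin
  f zero + g zero + sumF (λ i → f (suc i) + g (suc i))  ≡⟨ cong (_+_ (f zero + g zero)) (sumF-distrib-+ (f ∘ suc) (g ∘ suc)) ⟩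
  f zero + g zero + (sumF (f ∘ suc) + sumF (g ∘ suc))  ≡⟨ interchange (f zero) (g zero) _ _ ⟩
  f zero + sumF (f ∘ suc) + (g zero + sumF (g ∘ suc))  ∎
  where open ≡-Reasoning

sumF-remove : ∀ {m} (i : Fin (suc m)) (f : Fin (suc m) → ℕ) → sumF f ≡ f i + sumF (f ∘ punchIn i)
sumF-remove zero            f = refl
sumF-remove {suc m} (suc i) f = begin
  f zero + sumF (f ∘ suc)                                  ≡⟨ cong (_+_ (f zero)) (sumF-remove i (f ∘ suc)) ⟩
  f zero + (f (suc i) + sumF (f ∘ suc ∘ punchIn i))        ≡⟨ x∙yz≈y∙xz (f zero) (f (suc i)) _ ⟩
  f (suc i) + (f zero + sumF (f ∘ suc ∘ punchIn i))        ∎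
  where open ≡-Reasoning

count : ∀ {m} → (Fin m → Bool) → ℕ
count p = sumF (λ i → if p i then 1 else 0)

count-≤ : ∀ {m} (p : Fin m → Bool) → count p ≤ m
count-≤ {zero}  p = z≤n
count-≤ {suc m} p with p zero
... | true  = s≤s (count-≤ (p ∘ suc))
... | false = ℕ.m≤n⇒m≤1+n (count-≤ (p ∘ suc))

count-true : ∀ {m} {p : Fin m → Bool} → (∀ i → p i ≡ true) → count p ≡ m
count-true {zero}          all = refl
count-true {suc m} {p} all rewrite all zero = cong suc (count-true (all ∘ suc))

count-false : ∀ {m} {p : Fin m → Bool} → (∀ i → p i ≡ false) → count p ≡ 0
count-false {zero}          none = refl
count-false {suc m} {p} none rewrite none zero = count-false (none ∘ suc)

false⇒count< : ∀ {m} (p : Fin m → Bool) i → p i ≡ false → count p ℕ.< m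
false⇒count< {suc m} p zero    p0≡false rewrite p0≡false = s≤s (count-≤ (p ∘ suc))
false⇒count< {suc m} p (suc i) pᵢ≡false with p zero
... | true  = s≤s (false⇒count< (p ∘ suc) i pᵢ≡false)
... | false = ℕ.m<n⇒m<1+n (false⇒count< (p ∘ suc) i pᵢ≡false)

count-full : ∀ {m} (p : Fin m → Bool) → m ≤ count p → ∀ i → p i ≡ true
count-full p m≤c i with p i in pᵢ
... | true  = refl
... | false = contradiction m≤c (ℕ.<⇒≱ (false⇒count< p i pᵢ))

count<⇒false : ∀ {m} (p : Fin m → Bool) → count p ℕ.< m → ∃ λ i → p i ≡ false
count<⇒false {suc m} p c<m with p zero in p0
... | false = zero , p0
... | true  = let i , pᵢ = count<⇒false (p ∘ suc) (ℕ.s≤s⁻¹ c<m) in suc i , pᵢ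

true⇒≢false : ∀ {b} → b ≡ true → ¬ b ≡ false
true⇒≢false refl ()

_==_ : ∀ {m} → Fin m → Fin m → Bool
i == j = does (i Fin.≟ j)

==-refl : ∀ {m} (i : Fin m) → (i == i) ≡ true
==-refl i = dec-true (i Fin.≟ i) refl

≢⇒==-false : ∀ {m} {i j : Fin m} → i ≢ j → (i == j) ≡ false
≢⇒==-false {i = i} {j} = dec-false (i Fin.≟ j)

count-== : ∀ {m} (c : Fin m) → count (_== c) ≡ 1
count-== {suc m} c = begin
  count (_== c)                                                     ≡⟨ sumF-remove c (λ j → if j == c then 1 else 0) ⟩
  (if c == c then 1 else 0) + count (λ j → punchIn c j == c)        ≡⟨ cong₂ (λ b n → (if b then 1 else 0) + n) (==-refl c)
                                                                         (count-false (λ j → ≢⇒==-false (Fin.punchInᵢ≢i c j))) ⟩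
  1                                                                 ∎
  where open ≡-Reasoning

Adj : ℕ → Set
Adj m = Fin m → Fin m → Bool

Symmetric : ∀ {m} → Adj m → Set
Symmetric A = ∀ i j → A i j ≡ A j i

Irreflexive : ∀ {m} → Adj m → Set
Irreflexive A = ∀ i → A i i ≡ false

removeVertex : ∀ {m} → Adj (suc m) → Fin (suc m) → Adj m
removeVertex A v i j = A (punchIn v i) (punchIn v j)

edges : ∀ {m} → Adj m → ℕ
edges A = sumF λ i → count λ j → (toℕ i <ᵇ toℕ j) ∧ A i j

edges-cong : ∀ {m} {A B : Adj m} → (∀ i j → A i j ≡ B i j) → edges A ≡ edges B
edges-cong A≗B = sumF-cong λ i → sumF-cong λ j → cong (λ b → if (toℕ i <ᵇ toℕ j) ∧ b then 1 else 0) (A≗B i j)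

punchIn-<ᵇ : ∀ {m} (v : Fin (suc m)) i j → (toℕ (punchIn v i) <ᵇ toℕ (punchIn v j)) ≡ (toℕ i <ᵇ toℕ j)
punchIn-<ᵇ v i j = does-⇔ (mk⇔ cancel mono) (punchIn v i Fin.<? punchIn v j) (i Fin.<? j)
  where
  cancel : toℕ (punchIn v i) ℕ.< toℕ (punchIn v j) → toℕ i ℕ.< toℕ j
  cancel lt = Fin.≤∧≢⇒< (Fin.punchIn-cancel-≤ v i j (ℕ.<⇒≤ lt)) (λ { refl → Fin.<-irrefl refl lt })
  mono : toℕ i ℕ.< toℕ j → toℕ (punchIn v i) ℕ.< toℕ (punchIn v j)
  mono lt = Fin.≤∧≢⇒< (Fin.punchIn-mono-≤ v i j (ℕ.<⇒≤ lt)) (Fin.<⇒≢ lt ∘ Fin.punchIn-injective v i j)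

ordered-pair-split : ∀ {m} {x y : Fin m} (a : Bool) → x ≢ y →
  (if (toℕ x <ᵇ toℕ y) ∧ a then 1 else 0) + (if (toℕ y <ᵇ toℕ x) ∧ a then 1 else 0) ≡ (if a then 1 else 0)
ordered-pair-split {x = x} {y} a x≢y with Fin.<-cmp x y
... | tri< x<y _ y≮x rewrite dec-true (x Fin.<? y) x<y | dec-false (y Fin.<? x) y≮x = ℕ.+-identityʳ _
... | tri≈ _ x≡y _ = contradiction x≡y x≢y
... | tri> x≮y _ y<x rewrite dec-false (x Fin.<? y) x≮y | dec-true (y Fin.<? x) y<x = refl

count-removeVertex : ∀ {m} {A : Adj (suc m)} → Irreflexive A → ∀ v → count (A v) ≡ count (A v ∘ punchIn v)
count-removeVertex {A = A} A-irr v = trans (sumF-remove v (λ u → if A v u then 1 else 0))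
                                          (cong (λ b → (if b then 1 else 0) + count (A v ∘ punchIn v)) (A-irr v))

edges-removeVertex : ∀ {m} (A : Adj (suc m)) → Symmetric A → Irreflexive A → ∀ v →
                     edges A ≡ count (A v) + edges (removeVertex A v)
edges-removeVertex {m} A A-sym A-irr v = begin
  edges A                                         ≡⟨ sumF-remove v (λ i → sumF (c i)) ⟩
  sumF (c v) + sumF (λ i → sumF (c (pi i)))      ≡⟨ cong₂ _+_ (sumF-remove v (c v)) (sumF-cong λ i → sumF-remove v (c (pi i))) ⟩
  c v v + X + sumF (λ i → c (pi i) v + sumF (λ j → c (pi i) (pi j)))
                                                  ≡⟨ cong₂ (λ z w → z + X + w) cvv≡0 (sumF-distrib-+ (λ i → c (pi i) v) _) ⟩
  X + (Y + Z)                                     ≡⟨ ≡.sym (ℕ.+-assoc X Y Z) ⟩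
  X + Y + Z                                       ≡⟨ cong (_+ Z) (≡.sym (sumF-distrib-+ (λ j → c v (pi j)) (λ j → c (pi j) v))) ⟩
  sumF (λ j → c v (pi j) + c (pi j) v) + Z        ≡⟨ cong (_+ Z) (sumF-cong split) ⟩
  count (A v ∘ pi) + Z                            ≡⟨ cong₂ _+_ (≡.sym (count-removeVertex {A = A} A-irr v))
                                                       (sumF-cong λ i → sumF-cong λ j →
                                                         cong (λ b → if b ∧ removeVertex A v i j then 1 else 0) (punchIn-<ᵇ v i j)) ⟩
  count (A v) + edges (removeVertex A v)          ∎
  where
  open ≡-Reasoning
  pi : Fin m → Fin (suc m)
  pi = punchIn v
  c : Fin (suc m) → Fin (suc m) → ℕ
  c i j = if (toℕ i <ᵇ toℕ j) ∧ A i j then 1 else 0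
  X Y Z : ℕ
  X = sumF (λ j → c v (pi j))
  Y = sumF (λ i → c (pi i) v)
  Z = sumF (λ i → sumF (λ j → c (pi i) (pi j)))
  cvv≡0 : c v v ≡ 0
  cvv≡0 rewrite A-irr v | Bool.∧-zeroʳ (toℕ v <ᵇ toℕ v) = refl
  split : ∀ j → c v (pi j) + c (pi j) v ≡ (if A v (pi j) then 1 else 0)
  split j rewrite A-sym (pi j) v = ordered-pair-split (A v (pi j)) (Fin.punchInᵢ≢i v j ∘ ≡.sym)

edges-removeVertex-≤ : ∀ {m} (A : Adj (suc m)) → Symmetric A → Irreflexive A → ∀ v → edges (removeVertex A v) ≤ edges A
edges-removeVertex-≤ A A-sym A-irr v =
  subst (edges (removeVertex A v) ≤_) (≡.sym (edges-removeVertex A A-sym A-irr v)) (ℕ.m≤n+m _ (count (A v)))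

_∪_ : ∀ {m} → Adj m → Adj m → Adj m
(A ∪ B) i j = A i j ∨ B i j

∅ : ∀ {m} → Adj m
∅ _ _ = false

edge : ∀ {m} → Fin m → Fin m → Adj m
edge a c x y = (x == a ∧ y == c) ∨ (x == c ∧ y == a)

IsClique : ∀ {m} → Adj m → Set
IsClique A = ∀ i j → i ≢ j → A i j ≡ true

edges-∪ : ∀ {m} (A B : Adj m) → edges (A ∪ B) ≤ edges A + edges B
edges-∪ A B = begin
  edges (A ∪ B)                                          ≤⟨ sumF-mono-≤ (λ i → sumF-mono-≤ (λ j → indicator-∨ (toℕ i <ᵇ toℕ j) (A i j) (B i j))) ⟩
  sumF (λ i → sumF (λ j → a i j + b i j))                ≡⟨ sumF-cong (λ i → sumF-distrib-+ (a i) (b i)) ⟩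
  sumF (λ i → sumF (a i) + sumF (b i))                   ≡⟨ sumF-distrib-+ (sumF ∘ a) (sumF ∘ b) ⟩
  edges A + edges B                                      ∎
  where
  open ℕ.≤-Reasoning
  a b : Fin _ → Fin _ → ℕ
  a i j = if (toℕ i <ᵇ toℕ j) ∧ A i j then 1 else 0
  b i j = if (toℕ i <ᵇ toℕ j) ∧ B i j then 1 else 0
  indicator-∨ : ∀ t x y → (if t ∧ (x ∨ y) then 1 else 0) ≤ (if t ∧ x then 1 else 0) + (if t ∧ y then 1 else 0)
  indicator-∨ false x     y = z≤n
  indicator-∨ true  true  y = s≤s z≤n
  indicator-∨ true  false y = ℕ.≤-refl

edges-∅ : ∀ {m} → edges {m} ∅ ≡ 0
edges-∅ {zero}  = refl
edges-∅ {suc m} = trans (edges-removeVertex {m} ∅ (λ _ _ → refl) (λ _ → refl) zero) (cong₂ _+_ (count-false {m} λ _ → refl) (edges-∅ {m}))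

edges-complete : ∀ {m} {A : Adj m} → Symmetric A → Irreflexive A → IsClique A → edges A ≡ m C 2
edges-complete {zero}          A-sym A-irr complete = refl
edges-complete {suc m} {A = A} A-sym A-irr complete = begin
  edges A                                       ≡⟨ edges-removeVertex A A-sym A-irr zero ⟩
  count (A zero) + edges (removeVertex A zero)  ≡⟨ cong₂ _+_ row (edges-complete (λ i j → A-sym (suc i) (suc j)) (A-irr ∘ suc)
                                                                  (λ i j i≢j → complete (suc i) (suc j) (i≢j ∘ Fin.suc-injective))) ⟩
  m + m C 2                                     ≡⟨ cong (_+ m C 2) (≡.sym (nC1≡n m)) ⟩
  m C 1 + m C 2                                 ≡⟨ nCk+nC[k+1]≡[n+1]C[k+1] m 1 ⟩
  suc m C 2                                     ∎
  where
  open ≡-Reasoning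
  row : count (A zero) ≡ m
  row = trans (count-removeVertex {A = A} A-irr zero) (count-true λ j → complete zero (suc j) λ ())

edge-sym : ∀ {m} (a c : Fin m) → Symmetric (edge a c)
edge-sym a c x y = trans (cong₂ _∨_ (Bool.∧-comm (x == a) (y == c)) (Bool.∧-comm (x == c) (y == a))) (Bool.∨-comm (y == c ∧ x == a) (y == a ∧ x == c))

edge-irr : ∀ {m} {a c : Fin m} → a ≢ c → Irreflexive (edge a c)
edge-irr {a = a} {c} a≢c x with x Fin.≟ a
... | yes refl rewrite ≢⇒==-false a≢c = refl
... | no x≢a   rewrite Bool.∧-zeroʳ (x == c) = refl

edge-ac : ∀ {m} (a c : Fin m) → edge a c a c ≡ true
edge-ac a c rewrite ==-refl a | ==-refl c = refl

edge-ca : ∀ {m} (a c : Fin m) → edge a c c a ≡ true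
edge-ca a c rewrite ==-refl a | ==-refl c = Bool.∨-zeroʳ (c == a ∧ a == c)

edges-edge : ∀ {m} {a c : Fin m} → a ≢ c → edges (edge a c) ≡ 1
edges-edge {suc m} {a} {c} a≢c = begin
  edges (edge a c)                                          ≡⟨ edges-removeVertex (edge a c) (edge-sym a c) (edge-irr a≢c) a ⟩
  count (edge a c a) + edges (removeVertex (edge a c) a)    ≡⟨ cong₂ _+_ (trans (sumF-cong row) (count-== c))
                                                                 (trans (edges-cong avoiding-a) (edges-∅ {m})) ⟩
  1                                                         ∎
  where
  open ≡-Reasoning
  row : ∀ y → (if edge a c a y then 1 else 0) ≡ (if y == c then 1 else 0)
  row y rewrite ==-refl a | ≢⇒==-false a≢c | Bool.∨-identityʳ (y == c) = refl
  avoiding-a : ∀ x y → removeVertex (edge a c) a x y ≡ false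
  avoiding-a x y rewrite ≢⇒==-false (Fin.punchInᵢ≢i a x) | ≢⇒==-false (Fin.punchInᵢ≢i a y)
                       | Bool.∧-zeroʳ (punchIn a x == c) = refl

record Enumeration {m} (p : Fin m → Bool) (d : ℕ) : Set where
  field
    at        : Fin d → Fin m
    injective : Injective _≡_ _≡_ at
    member    : ∀ i → p (at i) ≡ true
    onto      : ∀ u → p u ≡ true → ∃ λ i → at i ≡ u

enumerate : ∀ {m} (p : Fin m → Bool) → Enumeration p (count p)
enumerate {zero}  p = record { at = λ () ; injective = λ {} ; member = λ () ; onto = λ () }
enumerate {suc m} p with p zero in p0 | enumerate (p ∘ suc)
... | true  | rest = record { at = at′ ; injective = injective′ ; member = member′ ; onto = onto′ }
  where
  open Enumeration rest
  at′ : Fin (suc (count (p ∘ suc))) → Fin (suc m)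
  at′ zero    = zero
  at′ (suc i) = suc (at i)
  injective′ : Injective _≡_ _≡_ at′
  injective′ {zero}  {zero}  _  = refl
  injective′ {suc i} {suc j} eq = cong suc (injective (Fin.suc-injective eq))
  member′ : ∀ i → p (at′ i) ≡ true
  member′ zero    = p0
  member′ (suc i) = member i
  onto′ : ∀ u → p u ≡ true → ∃ λ i → at′ i ≡ u
  onto′ zero    _  = zero , refl
  onto′ (suc u) pu = let i , eq = onto u pu in suc i , cong suc eq
... | false | rest = record { at = suc ∘ at ; injective = injective ∘ Fin.suc-injective ; member = member ; onto = onto′ }
  where
  open Enumeration rest
  onto′ : ∀ u → p u ≡ true → ∃ λ i → suc (at i) ≡ u
  onto′ zero    pu = ⊥-elim (true⇒≢false pu p0)
  onto′ (suc u) pu = let i , eq = onto u pu in i , cong suc eq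

-- Neighbourhoods and cuts

∈⇒lookup : ∀ {m} {p : Subset m} {x} → x ∈ p → lookup p x ≡ true
∈⇒lookup = Vec.[]=⇒lookup

lookup⇒∈ : ∀ {m} {p : Subset m} {x} → lookup p x ≡ true → x ∈ p
lookup⇒∈ {p = p} {x} = Vec.lookup⇒[]= x p

∈N⇒adj : ∀ (G : Graph) {v u} → u ∈ N G v → adj G v u ≡ true
∈N⇒adj G {v} {u} u∈N = trans (≡.sym (Vec.lookup∘tabulate (adj G v) u)) (∈⇒lookup u∈N)

adj⇒∈N : ∀ (G : Graph) {v u} → adj G v u ≡ true → u ∈ N G v
adj⇒∈N G {v} {u} vu = lookup⇒∈ (trans (Vec.lookup∘tabulate (adj G v) u) vu)

Reach-source : ∀ {G M u w} → Reach G M u w → u ∉ M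
Reach-source (here u∉M)     = u∉M
Reach-source (step u∉M _ _) = u∉M

Reach-trans : ∀ {G M u w z} → Reach G M u w → Reach G M w z → Reach G M u z
Reach-trans (here _)          r = r
Reach-trans (step u∉M uw r₁) r₂ = step u∉M uw (Reach-trans r₁ r₂)

N-isVertexCut : ∀ (G : Graph) {v w} → w ≢ v → adj G v w ≡ false → VertexCut G (N G v)
N-isVertexCut G {v} {w} w≢v vw≡false = v , w , v∉N , w∉N , leaves
  where
  v∉N : v ∉ N G v
  v∉N v∈N = true⇒≢false (∈N⇒adj G v∈N) (irrefl G v)
  w∉N : w ∉ N G v
  w∉N w∈N = true⇒≢false (∈N⇒adj G w∈N) vw≡false
  leaves : ¬ Reach G (N G v) v w
  leaves (here _)        = w≢v refl
  leaves (step _ vu r)   = Reach-source r (adj⇒∈N G vu)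

adjacent⇒≢ : ∀ {m} (A : Adj m) → Irreflexive A → ∀ {i j} → A i j ≡ true → i ≢ j
adjacent⇒≢ A A-irr {i} Aij refl = true⇒≢false Aij (A-irr i)

NoTriangle : ∀ {d} → Adj d → Set
NoTriangle B = ∀ i j l → B i j ≡ true → B j l ≡ true → ¬ B l i ≡ true

NoSquare : ∀ {d} → Adj d → Set
NoSquare B = ∀ i j l o → i ≢ l → j ≢ o → B i j ≡ true → B j l ≡ true → B l o ≡ true → ¬ B o i ≡ true

ProperlyColours : ∀ {d} → Subset d → Adj d → Set
ProperlyColours S B = ∀ i j → B i j ≡ true → lookup S i ≢ lookup S j

-- On at most four vertices, having no triangle and no 4-cycle means being a forest (see forest-lifts).
LocalClass : Class → ∀ {d} → Adj d → Set
LocalClass 𝔉 B = NoTriangle B × NoSquare B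
LocalClass 𝔅 B = ∃ λ S → ProperlyColours S B

module _ (G : Graph) {X : Subset (n G)} {d} {g : Fin d → Fin (n G)} (g-injective : Injective _≡_ _≡_ g)
         (onto : ∀ u → u ∈ X → ∃ λ i → g i ≡ u) {B : Adj d} (g-adj : ∀ i j → adj G (g i) (g j) ≡ B i j) where

  colouring-lifts : ∀ {S} → ProperlyColours S B → IsBipartiteOn G X
  colouring-lifts {S} proper = colour , separates
    where
    colour : Fin (n G) → Bool
    colour u with u ∈? X
    ... | yes u∈X = lookup S (proj₁ (onto u u∈X))
    ... | no  _   = false
    colour-at : ∀ {u} → u ∈ X → ∃ λ i → g i ≡ u × colour u ≡ lookup S i
    colour-at {u} u∈X with u ∈? X
    ... | yes u∈X′ = proj₁ (onto u u∈X′) , proj₂ (onto u u∈X′) , refl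
    ... | no  u∉X  = contradiction u∈X u∉X
    separates : ∀ u w → u ∈ X → w ∈ X → adj G u w ≡ true → colour u ≢ colour w
    separates u w u∈X w∈X uw with colour-at u∈X | colour-at w∈X
    ... | i , refl , cu | j , refl , cw =
      λ same → proper i j (trans (≡.sym (g-adj i j)) uw) (trans (≡.sym cu) (trans same cw))

  module Indexing {N} {f : Fin N → Fin (n G)} (f-injective : Injective _≡_ _≡_ f) (f∈X : ∀ t → f t ∈ X) where
    index : Fin N → Fin d
    index t = proj₁ (onto (f t) (f∈X t))

    g∘index : ∀ t → g (index t) ≡ f t
    g∘index t = proj₂ (onto (f t) (f∈X t))

    index-≢ : ∀ {t t′} → t ≢ t′ → index t ≢ index t′
    index-≢ t≢t′ eq = t≢t′ (f-injective (trans (≡.sym (g∘index _)) (trans (cong g eq) (g∘index _))))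

    index-adj : ∀ {t t′} → adj G (f t) (f t′) ≡ true → B (index t) (index t′) ≡ true
    index-adj {t} {t′} ftt′ = trans (≡.sym (g-adj (index t) (index t′))) (trans (cong₂ (adj G) (g∘index t) (g∘index t′)) ftt′)

  forest-lifts : d ≤ 4 → NoTriangle B → NoSquare B → IsForestOn G X
  forest-lifts d≤4 no-triangle no-square (m , f , f-injective , f∈X , path , closing) = acyclic m f-injective f∈X path closing
    where
    acyclic : ∀ m {f : Fin (suc (suc (suc m))) → Fin (n G)} → Injective _≡_ _≡_ f → (∀ t → f t ∈ X) →
              (∀ (t : Fin (suc (suc m))) → adj G (f (inject₁ t)) (f (suc t)) ≡ true) →
              adj G (f (fromℕ (suc (suc m)))) (f zero) ≡ true → ⊥
    acyclic zero f-injective f∈X path closing =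
      no-triangle (index 0F) (index 1F) (index 2F) (index-adj (path 0F)) (index-adj (path 1F)) (index-adj closing)
      where open Indexing f-injective f∈X
    acyclic (suc zero) f-injective f∈X path closing =
      no-square (index 0F) (index 1F) (index 2F) (index 3F) (index-≢ λ ()) (index-≢ λ ())
        (index-adj (path 0F)) (index-adj (path 1F)) (index-adj (path 2F)) (index-adj closing)
      where open Indexing f-injective f∈X
    acyclic (suc (suc m)) f-injective f∈X _ _ =
      let i , j , i<j , same = Fin.pigeonhole (ℕ.≤-trans (s≤s d≤4) (ℕ.m≤m+n 5 m)) index in index-≢ (Fin.<⇒≢ i<j) same
      where open Indexing f-injective f∈X

  localClass-lifts : ∀ Ψ → d ≤ 4 → LocalClass Ψ B → InClassOn Ψ G X
  localClass-lifts 𝔉 d≤4 (no-triangle , no-square) = forest-lifts d≤4 no-triangle no-square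
  localClass-lifts 𝔅 _   (S , proper)              = colouring-lifts {S} proper

no-three-distinct : ∀ {d} → d ≤ 2 → (i j l : Fin d) → i ≢ j → j ≢ l → i ≢ l → ⊥
no-three-distinct (s≤s z≤n)       0F 0F _  i≢j _   _   = i≢j refl
no-three-distinct (s≤s (s≤s z≤n)) 0F 0F _  i≢j _   _   = i≢j refl
no-three-distinct (s≤s (s≤s z≤n)) 1F 1F _  i≢j _   _   = i≢j refl
no-three-distinct (s≤s (s≤s z≤n)) 0F 1F 0F _   _   i≢l = i≢l refl
no-three-distinct (s≤s (s≤s z≤n)) 0F 1F 1F _   j≢l _   = j≢l refl
no-three-distinct (s≤s (s≤s z≤n)) 1F 0F 0F _   j≢l _   = j≢l refl
no-three-distinct (s≤s (s≤s z≤n)) 1F 0F 1F _   _   i≢l = i≢l refl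

localClass-≤2 : ∀ Ψ {d} {B : Adj d} → Irreflexive B → d ≤ 2 → LocalClass Ψ B
localClass-≤2 𝔉 {B = B} B-irr d≤2 = no-triangle , no-square
  where
  no-triangle : NoTriangle B
  no-triangle i j l ij jl li = no-three-distinct d≤2 i j l (adjacent⇒≢ B B-irr ij) (adjacent⇒≢ B B-irr jl) (adjacent⇒≢ B B-irr li ∘ ≡.sym)
  no-square : NoSquare B
  no-square i j l o i≢l _ ij jl _ _ = no-three-distinct d≤2 i j l (adjacent⇒≢ B B-irr ij) (adjacent⇒≢ B B-irr jl) i≢l
localClass-≤2 𝔅 B-irr z≤n = [] , λ ()
localClass-≤2 𝔅 {B = B} B-irr (s≤s z≤n) = (true ∷ []) , λ { 0F 0F B00 → ⊥-elim (adjacent⇒≢ B B-irr B00 refl) }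
localClass-≤2 𝔅 {B = B} B-irr (s≤s (s≤s z≤n)) = (true ∷ false ∷ []) , proper
  where
  proper : ProperlyColours (true ∷ false ∷ []) B
  proper 0F 0F B00 = ⊥-elim (adjacent⇒≢ B B-irr B00 refl)
  proper 1F 1F B11 = ⊥-elim (adjacent⇒≢ B B-irr B11 refl)
  proper 0F 1F _   = λ ()
  proper 1F 0F _   = λ ()

-- Deleting a vertex

∪-introˡ : ∀ {m} {A B : Adj m} {x y} → A x y ≡ true → (A ∪ B) x y ≡ true
∪-introˡ {B = B} {x} {y} Axy = cong (_∨ B x y) Axy

∪-introʳ : ∀ {m} {A B : Adj m} {x y} → B x y ≡ true → (A ∪ B) x y ≡ true
∪-introʳ {A = A} {x = x} {y} Bxy = trans (cong (A x y ∨_) Bxy) (Bool.∨-zeroʳ (A x y))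

module VertexDeletion {k} (A : Adj (suc k)) (A-sym : Symmetric A) (A-irr : Irreflexive A) (v : Fin (suc k))
                      (E : Adj (suc k)) (E-sym : Symmetric E) (E-irr : Irreflexive E) where

  G : Graph
  G = record { n = suc k ; adj = A ; sym = A-sym ; irrefl = A-irr }

  G′ : Graph
  G′ = record { n = k ; adj = removeVertex (A ∪ E) v
              ; sym = λ i j → cong₂ _∨_ (A-sym _ _) (E-sym _ _) ; irrefl = λ i → cong₂ _∨_ (A-irr _) (E-irr _) }

  e-G′ : e G′ + deg G v ≤ e G + edges E
  e-G′ = begin
    edges (removeVertex (A ∪ E) v) + count (A v)                  ≤⟨ ℕ.+-monoˡ-≤ (count (A v)) (edges-∪ (removeVertex A v) (removeVertex E v)) ⟩
    edges (removeVertex A v) + edges (removeVertex E v) + count (A v)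
                                                                   ≤⟨ ℕ.+-monoˡ-≤ (count (A v)) (ℕ.+-monoʳ-≤ (edges (removeVertex A v)) (edges-removeVertex-≤ E E-sym E-irr v)) ⟩
    edges (removeVertex A v) + edges E + count (A v)              ≡⟨ ℕ.+-comm _ (count (A v)) ⟩
    count (A v) + (edges (removeVertex A v) + edges E)            ≡⟨ ≡.sym (ℕ.+-assoc (count (A v)) _ _) ⟩
    count (A v) + edges (removeVertex A v) + edges E              ≡⟨ cong (_+ edges E) (≡.sym (edges-removeVertex A A-sym A-irr v)) ⟩
    edges A + edges E                                             ∎
    where open ℕ.≤-Reasoning

  q-G′-pos : ∀ {α β} → α ≤ℚ toℚ 3 → edges E + 3 ≤ deg G v → 0ℚ < q α β G → 0ℚ < q α β G′
  q-G′-pos α≤3 E+3≤deg = q-pos-deletion G G′ α≤3 refl (ℕ.+-cancelʳ-≤ (edges E) (e G′ + 3) (e G) (begin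
    e G′ + 3 + edges E       ≡⟨ ℕ.+-assoc (e G′) 3 (edges E) ⟩
    e G′ + (3 + edges E)     ≤⟨ ℕ.+-monoʳ-≤ (e G′) (subst (_≤ deg G v) (ℕ.+-comm (edges E) 3) E+3≤deg) ⟩
    e G′ + deg G v           ≤⟨ e-G′ ⟩
    e G + edges E            ∎))
    where open ℕ.≤-Reasoning

  lift : Bool → Subset k → Subset (suc k)
  lift b M′ = insertAt M′ v b

  punchIn∈lift⇒∈ : ∀ {b M′ i} → punchIn v i ∈ lift b M′ → i ∈ M′
  punchIn∈lift⇒∈ {b} {M′} {i} i∈ = lookup⇒∈ (trans (≡.sym (Vec.insertAt-punchIn M′ v b i)) (∈⇒lookup i∈))

  ∈⇒punchIn∈lift : ∀ {b M′ i} → i ∈ M′ → punchIn v i ∈ lift b M′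
  ∈⇒punchIn∈lift {b} {M′} {i} i∈ = lookup⇒∈ (trans (Vec.insertAt-punchIn M′ v b i) (∈⇒lookup i∈))

  punchIn∉⇒∉ : ∀ {b M′ i} → punchIn v i ∉ lift b M′ → i ∉ M′
  punchIn∉⇒∉ i∉ = i∉ ∘ ∈⇒punchIn∈lift

  ∉⇒punchIn∉ : ∀ {b M′ i} → i ∉ M′ → punchIn v i ∉ lift b M′
  ∉⇒punchIn∉ i∉ = i∉ ∘ punchIn∈lift⇒∈

  v∈lift-true : ∀ {M′} → v ∈ lift true M′
  v∈lift-true {M′} = lookup⇒∈ (Vec.insertAt-lookup M′ v true)

  v∉lift-false : ∀ {M′} → v ∉ lift false M′
  v∉lift-false {M′} v∈ = true⇒≢false (∈⇒lookup v∈) (Vec.insertAt-lookup M′ v false)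

  data Vertex : Fin (suc k) → Set where
    deleted : Vertex v
    kept    : ∀ u → Vertex (punchIn v u)

  vertex : ∀ u → Vertex u
  vertex u with v Fin.≟ u
  ... | yes refl = deleted
  ... | no  v≢u  = subst Vertex (Fin.punchIn-punchOut v≢u) (kept (punchOut v≢u))

  A⇒A∪E : ∀ {x y} → A x y ≡ true → (A ∪ E) x y ≡ true
  A⇒A∪E = ∪-introˡ {A = A} {B = E}

  E⇒A∪E : ∀ {x y} → E x y ≡ true → (A ∪ E) x y ≡ true
  E⇒A∪E = ∪-introʳ {A = A} {B = E}

  project-cycle : ∀ {b M′ m} {f : Fin (suc (suc (suc m))) → Fin (suc k)} → Injective _≡_ _≡_ f →
    (∀ t → f t ≢ v) → (∀ t → f t ∈ lift b M′) →
    (∀ (t : Fin (suc (suc m))) → (A ∪ E) (f (inject₁ t)) (f (suc t)) ≡ true) →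
    (A ∪ E) (f (fromℕ (suc (suc m)))) (f zero) ≡ true → CycleIn G′ M′
  project-cycle {m = m} {f} f-injective f≢v f∈ path closing = m , f′ , f′-injective , f′∈ , adj′ ∘ path , adj′ closing
    where
    f′ : Fin (suc (suc (suc m))) → Fin k
    f′ t = punchOut (f≢v t ∘ ≡.sym)
    punchIn∘f′ : ∀ t → punchIn v (f′ t) ≡ f t
    punchIn∘f′ t = Fin.punchIn-punchOut (f≢v t ∘ ≡.sym)
    f′-injective : Injective _≡_ _≡_ f′
    f′-injective eq = f-injective (trans (≡.sym (punchIn∘f′ _)) (trans (cong (punchIn v) eq) (punchIn∘f′ _)))
    f′∈ : ∀ t → f′ t ∈ _
    f′∈ t = punchIn∈lift⇒∈ (subst (_∈ _) (≡.sym (punchIn∘f′ t)) (f∈ t))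
    adj′ : ∀ {t t′} → (A ∪ E) (f t) (f t′) ≡ true → adj G′ (f′ t) (f′ t′) ≡ true
    adj′ {t} {t′} = subst (_≡ true) (≡.sym (cong₂ (A ∪ E) (punchIn∘f′ t) (punchIn∘f′ t′)))

  hereditary : ∀ Ψ {M′} → InClassOn Ψ G′ M′ → InClassOn Ψ G (lift false M′)
  hereditary 𝔉 {M′} forest (m , f , f-injective , f∈ , path , closing) =
    forest (project-cycle f-injective f≢v f∈ (A⇒A∪E ∘ path) (A⇒A∪E closing))
    where
    f≢v : ∀ t → f t ≢ v
    f≢v t ft≡v = v∉lift-false (subst (_∈ lift false M′) ft≡v (f∈ t))
  hereditary 𝔅 {M′} (colour′ , proper) = colour , separates
    where
    colour : Fin (suc k) → Bool
    colour u with v Fin.≟ u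
    ... | yes _   = false
    ... | no  v≢u = colour′ (punchOut v≢u)
    colour-punchIn : ∀ i → colour (punchIn v i) ≡ colour′ i
    colour-punchIn i with v Fin.≟ punchIn v i
    ... | yes v≡ = contradiction (≡.sym v≡) (Fin.punchInᵢ≢i v i)
    ... | no  v≢ = cong colour′ (Fin.punchOut-punchIn v)
    separates : ∀ u w → u ∈ lift false M′ → w ∈ lift false M′ → A u w ≡ true → colour u ≢ colour w
    separates u w u∈ w∈ uw with vertex u | vertex w
    ... | deleted | _       = contradiction u∈ v∉lift-false
    ... | kept _  | deleted = contradiction w∈ v∉lift-false
    ... | kept i  | kept j  rewrite colour-punchIn i | colour-punchIn j =
      proper i j (punchIn∈lift⇒∈ u∈) (punchIn∈lift⇒∈ w∈) (A⇒A∪E uw)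

  ConnectsNeighbours : Subset k → Set
  ConnectsNeighbours M′ = ∀ x y → A v (punchIn v x) ≡ true → A v (punchIn v y) ≡ true → x ∉ M′ → y ∉ M′ → Reach G′ M′ x y

  module _ {M′ : Subset k} (connects : ConnectsNeighbours M′) where

    -- A path avoiding lift false M′ is projected to G′; each visit to v is bypassed between two neighbours of v.
    project-path : ∀ {a b} → Reach G (lift false M′) a (punchIn v b) →
      (∀ a′ → punchIn v a′ ≡ a → Reach G′ M′ a′ b) ×
      (a ≡ v → ∀ y → A v (punchIn v y) ≡ true → y ∉ M′ → Reach G′ M′ y b)
    project-path {b = b} (here b∉) =
      (λ a′ eq → subst (λ x → Reach G′ M′ x b) (≡.sym (Fin.punchIn-injective v a′ b eq)) (here (punchIn∉⇒∉ b∉)))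
      , (λ b≡v → contradiction b≡v (Fin.punchInᵢ≢i v b))
    project-path (step {a} {w} a∉ aw r) with vertex w
    ... | deleted =
      (λ a′ eq → proj₂ (project-path r) refl a′ (trans (A-sym v (punchIn v a′)) (trans (cong (λ x → A x v) eq) aw))
                   (punchIn∉⇒∉ (subst (_∉ lift false M′) (≡.sym eq) a∉)))
      , (λ a≡v → ⊥-elim (adjacent⇒≢ A A-irr aw a≡v))
    ... | kept w′ =
      (λ { a′ refl → step (punchIn∉⇒∉ a∉) (A⇒A∪E aw) (proj₁ (project-path r) w′ refl) })
      , (λ { refl y vy y∉ → Reach-trans (connects y w′ vy aw y∉ (punchIn∉⇒∉ (Reach-source r))) (proj₁ (project-path r) w′ refl) })

    lift-ΨCut : ∀ {Ψ} → ΨCut Ψ G′ M′ → ΨCut Ψ G (lift false M′)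
    lift-ΨCut {Ψ} ((x , y , x∉ , y∉ , x↛y) , inΨ) =
      (punchIn v x , punchIn v y , ∉⇒punchIn∉ x∉ , ∉⇒punchIn∉ y∉ , λ r → x↛y (proj₁ (project-path r) x refl))
      , hereditary Ψ inΨ

  project-path-avoiding-v : ∀ {M′ a b} → Reach G (lift true M′) a (punchIn v b) → ∀ a′ → punchIn v a′ ≡ a → Reach G′ M′ a′ b
  project-path-avoiding-v {M′} {b = b} (here b∉) a′ eq =
    subst (λ x → Reach G′ M′ x b) (≡.sym (Fin.punchIn-injective v a′ b eq)) (here (punchIn∉⇒∉ b∉))
  project-path-avoiding-v (step {w = w} a∉ aw r) a′ refl with vertex w
  ... | deleted = contradiction v∈lift-true (Reach-source r)
  ... | kept w′ = step (punchIn∉⇒∉ a∉) (A⇒A∪E aw) (project-path-avoiding-v r w′ refl)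

  lift-VertexCut : ∀ {M′} → VertexCut G′ M′ → VertexCut G (lift true M′)
  lift-VertexCut (x , y , x∉ , y∉ , x↛y) =
    punchIn v x , punchIn v y , ∉⇒punchIn∉ x∉ , ∉⇒punchIn∉ y∉ , λ r → x↛y (project-path-avoiding-v r x refl)

  hub-connects : ∀ {M′} h → h ∉ M′ → (∀ x → A v (punchIn v x) ≡ true → x ≡ h ⊎ adj G′ x h ≡ true) → ConnectsNeighbours M′
  hub-connects {M′} h h∉ hub x y vx vy x∉ y∉ = Reach-trans (to-hub x vx x∉) (from-hub y vy y∉)
    where
    to-hub : ∀ x → A v (punchIn v x) ≡ true → x ∉ M′ → Reach G′ M′ x h
    to-hub x vx x∉ with hub x vx
    ... | inj₁ refl = here x∉
    ... | inj₂ xh   = step x∉ xh (here h∉)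
    from-hub : ∀ y → A v (punchIn v y) ≡ true → y ∉ M′ → Reach G′ M′ h y
    from-hub y vy y∉ with hub y vy
    ... | inj₁ refl = here y∉
    ... | inj₂ yh   = step h∉ (trans (Graph.sym G′ h y) yh) (here y∉)

  unique-connects : ∀ {M′} → (∀ x y → A v (punchIn v x) ≡ true → A v (punchIn v y) ≡ true → x ∉ M′ → y ∉ M′ → x ≡ y) →
                    ConnectsNeighbours M′
  unique-connects unique x y vx vy x∉ y∉ with unique x y vx vy x∉ y∉
  ... | refl = here x∉

  clique-connects : ∀ {M′} → (∀ x y → A v (punchIn v x) ≡ true → A v (punchIn v y) ≡ true → x ≡ y ⊎ adj G′ x y ≡ true) →
                    ConnectsNeighbours M′
  clique-connects clique x y vx vy x∉ y∉ with clique x y vx vy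
  ... | inj₁ refl = here x∉
  ... | inj₂ xy   = step x∉ xy (here y∉)

-- Cyclic sequences and neighbourhoods that are 4-cycles

next : ∀ {N} → Fin (suc N) → Fin (suc N)
next {N} i with N ℕ.≟ toℕ i
... | yes _   = zero
... | no  N≢i = suc (lower₁ i N≢i)

next-inject₁ : ∀ {N} (j : Fin N) → next (inject₁ j) ≡ suc j
next-inject₁ {N} j with N ℕ.≟ toℕ (inject₁ j)
... | yes N≡j = contradiction N≡j (Fin.toℕ-inject₁-≢ j)
... | no  N≢j = cong suc (Fin.lower₁-inject₁′ j N≢j)

next-fromℕ : ∀ N → next (fromℕ N) ≡ zero
next-fromℕ N with N ℕ.≟ toℕ (fromℕ N)
... | yes _   = refl
... | no  N≢N = contradiction (≡.sym (Fin.toℕ-fromℕ N)) N≢N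

next-injective : ∀ {N} → Injective _≡_ _≡_ (next {N})
next-injective {N} {i} {j} eq with N ℕ.≟ toℕ i | N ℕ.≟ toℕ j | eq
... | yes N≡i | yes N≡j | _   = Fin.toℕ-injective (trans (≡.sym N≡i) N≡j)
... | no  N≢i | no  N≢j | eq′ = trans (≡.sym (Fin.inject₁-lower₁ i N≢i))
                                  (trans (cong inject₁ (Fin.suc-injective eq′)) (Fin.inject₁-lower₁ j N≢j))

rotation : ∀ {N} → ℕ → Fin (suc N) → Fin (suc N)
rotation zero    = id
rotation (suc s) = next ∘ rotation s

rotation-next : ∀ {N} s (i : Fin (suc N)) → rotation s (next i) ≡ next (rotation s i)
rotation-next zero    i = refl
rotation-next (suc s) i = cong next (rotation-next s i)

rotation-injective : ∀ {N} s → Injective _≡_ _≡_ (rotation {N} s)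
rotation-injective zero    eq = eq
rotation-injective (suc s) eq = rotation-injective s (next-injective eq)

rotation-toℕ : ∀ {N} (t : Fin (suc N)) → rotation (toℕ t) zero ≡ t
rotation-toℕ t = from-zero (toℕ t) t refl
  where
  from-zero : ∀ {N} s (t : Fin (suc N)) → toℕ t ≡ s → rotation s zero ≡ t
  from-zero zero    zero    _  = refl
  from-zero (suc s) (suc t) eq = trans (cong next (from-zero s (inject₁ t) (trans (Fin.toℕ-inject₁ t) (ℕ.suc-injective eq)))) (next-inject₁ t)

module _ {V : Set} (R : V → V → Set) where

  Cyclic : ∀ {N} → (Fin (suc N) → V) → Set
  Cyclic f = ∀ i → R (f i) (f (next i))

  cyclic : ∀ {N} {f : Fin (suc N) → V} → (∀ (j : Fin N) → R (f (inject₁ j)) (f (suc j))) → R (f (fromℕ N)) (f zero) → Cyclic f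
  cyclic {N} {f} path closing i with N ℕ.≟ toℕ i
  ... | yes N≡i = subst (λ x → R (f x) (f zero)) (Fin.toℕ-injective (trans (Fin.toℕ-fromℕ N) N≡i)) closing
  ... | no  N≢i = subst (λ x → R (f x) (f (suc (lower₁ i N≢i)))) (Fin.inject₁-lower₁ i N≢i) (path (lower₁ i N≢i))

  cyclic-path : ∀ {N} {f : Fin (suc N) → V} → Cyclic f → ∀ (j : Fin N) → R (f (inject₁ j)) (f (suc j))
  cyclic-path {f = f} cyc j = subst (R (f (inject₁ j)) ∘ f) (next-inject₁ j) (cyc (inject₁ j))

  cyclic-closing : ∀ {N} {f : Fin (suc N) → V} → Cyclic f → R (f (fromℕ N)) (f zero)
  cyclic-closing {N} {f} cyc = subst (R (f (fromℕ N)) ∘ f) (next-fromℕ N) (cyc (fromℕ N))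

  rotate : ∀ {N} {f : Fin (suc N) → V} → Cyclic f → ∀ t →
           ∃ λ (σ : Fin (suc N) → Fin (suc N)) → Injective _≡_ _≡_ σ × σ zero ≡ t × Cyclic (f ∘ σ)
  rotate {f = f} cyc t = rotation (toℕ t) , rotation-injective (toℕ t) , rotation-toℕ t ,
    λ i → subst (R (f (rotation (toℕ t) i)) ∘ f) (≡.sym (rotation-next (toℕ t) i)) (cyc (rotation (toℕ t) i))

module SquareNeighbourhood {k} (A : Adj (suc k)) (A-sym : Symmetric A) (A-irr : Irreflexive A)
  {v a b c d : Fin (suc k)} (a≢c : a ≢ c) (around : ∀ x → A v x ≡ true → x ≡ a ⊎ x ≡ b ⊎ x ≡ c ⊎ x ≡ d)
  (va : A v a ≡ true) (vb : A v b ≡ true) (vc : A v c ≡ true) (vd : A v d ≡ true)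
  (ab : A a b ≡ true) (bc : A b c ≡ true) (cd : A c d ≡ true) (da : A d a ≡ true) (ac : A a c ≡ false) where

  open VertexDeletion A A-sym A-irr v (edge a c) (edge-sym a c) (edge-irr a≢c)

  unpunch : ∀ {x} → A v x ≡ true → ∃ λ x′ → punchIn v x′ ≡ x
  unpunch vx = punchOut (adjacent⇒≢ A A-irr vx) , Fin.punchIn-punchOut (adjacent⇒≢ A A-irr vx)

  a′ b′ c′ d′ : Fin k
  a′ = proj₁ (unpunch va)
  b′ = proj₁ (unpunch vb)
  c′ = proj₁ (unpunch vc)
  d′ = proj₁ (unpunch vd)

  back : ∀ {x′ y} (vy : A v y ≡ true) → punchIn v x′ ≡ y → x′ ≡ proj₁ (unpunch vy)
  back vy eq = Fin.punchIn-injective v _ _ (trans eq (≡.sym (proj₂ (unpunch vy))))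

  around′ : ∀ x′ → A v (punchIn v x′) ≡ true → x′ ≡ a′ ⊎ x′ ≡ b′ ⊎ x′ ≡ c′ ⊎ x′ ≡ d′
  around′ x′ vx with around (punchIn v x′) vx
  ... | inj₁ x≡a               = inj₁ (back va x≡a)
  ... | inj₂ (inj₁ x≡b)        = inj₂ (inj₁ (back vb x≡b))
  ... | inj₂ (inj₂ (inj₁ x≡c)) = inj₂ (inj₂ (inj₁ (back vc x≡c)))
  ... | inj₂ (inj₂ (inj₂ x≡d)) = inj₂ (inj₂ (inj₂ (back vd x≡d)))

  adj′ : ∀ {x y} (vx : A v x ≡ true) (vy : A v y ≡ true) → (A ∪ edge a c) x y ≡ true →
         adj G′ (proj₁ (unpunch vx)) (proj₁ (unpunch vy)) ≡ true
  adj′ vx vy xy = trans (cong₂ (A ∪ edge a c) (proj₂ (unpunch vx)) (proj₂ (unpunch vy))) xy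

  hub-a : ∀ x′ → A v (punchIn v x′) ≡ true → x′ ≡ a′ ⊎ adj G′ x′ a′ ≡ true
  hub-a x′ vx with around′ x′ vx
  ... | inj₁ x≡a               = inj₁ x≡a
  ... | inj₂ (inj₁ refl)        = inj₂ (adj′ vb va (A⇒A∪E (trans (A-sym b a) ab)))
  ... | inj₂ (inj₂ (inj₁ refl)) = inj₂ (adj′ vc va (E⇒A∪E (edge-ca a c)))
  ... | inj₂ (inj₂ (inj₂ refl)) = inj₂ (adj′ vd va (A⇒A∪E da))

  hub-c : ∀ x′ → A v (punchIn v x′) ≡ true → x′ ≡ c′ ⊎ adj G′ x′ c′ ≡ true
  hub-c x′ vx with around′ x′ vx
  ... | inj₁ refl               = inj₂ (adj′ va vc (E⇒A∪E (edge-ac a c)))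
  ... | inj₂ (inj₁ refl)        = inj₂ (adj′ vb vc (A⇒A∪E bc))
  ... | inj₂ (inj₂ (inj₁ x≡c)) = inj₁ x≡c
  ... | inj₂ (inj₂ (inj₂ refl)) = inj₂ (adj′ vd vc (A⇒A∪E (trans (A-sym d c) cd)))

  Adjacent : Fin (suc k) → Fin (suc k) → Set
  Adjacent x y = A x y ≡ true

  module _ {M′ : Subset k} (forest : IsForestOn G′ M′) (a∈ : a′ ∈ M′) (c∈ : c′ ∈ M′) (b∉ : b′ ∉ M′) (d∉ : d′ ∉ M′) where

    in-star : ∀ {x} → x ∈ lift true M′ → A v x ≡ true → x ≡ a ⊎ x ≡ c
    in-star {x} x∈ vx with around x vx
    ... | inj₁ x≡a               = inj₁ x≡a
    ... | inj₂ (inj₁ refl)        = contradiction (subst (_∈ lift true M′) (≡.sym (proj₂ (unpunch vb))) x∈) (∉⇒punchIn∉ b∉)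
    ... | inj₂ (inj₂ (inj₁ x≡c)) = inj₂ x≡c
    ... | inj₂ (inj₂ (inj₂ refl)) = contradiction (subst (_∈ lift true M′) (≡.sym (proj₂ (unpunch vd))) x∈) (∉⇒punchIn∉ d∉)

    star-pair : ∀ {x y} → x ∈ lift true M′ → y ∈ lift true M′ → A v x ≡ true → A v y ≡ true → x ≢ y →
                edge a c x y ≡ true × A x y ≡ false
    star-pair x∈ y∈ vx vy x≢y with in-star x∈ vx | in-star y∈ vy
    ... | inj₁ refl | inj₁ refl = contradiction refl x≢y
    ... | inj₁ refl | inj₂ refl = edge-ac a c , ac
    ... | inj₂ refl | inj₁ refl = edge-ca a c , trans (A-sym c a) ac
    ... | inj₂ refl | inj₂ refl = contradiction refl x≢y

    -- A cycle through v leaves v towards a and c; replacing a–v–c by the new edge ac gives a cycle of G′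
    -- (a triangle v a c is impossible since a and c are not adjacent in G).
    through-v : ∀ m {g : Fin (suc (suc (suc m))) → Fin (suc k)} → Injective _≡_ _≡_ g → (∀ t → g t ∈ lift true M′) →
                g zero ≡ v → Cyclic Adjacent g → ⊥
    through-v m {g} g-injective g∈ g0≡v cyc = splice m g-injective g∈ g0≡v cyc pair
      where
      v-first : A v (g 1F) ≡ true
      v-first = subst (λ x → A x (g 1F) ≡ true) g0≡v (cyclic-path Adjacent cyc zero)
      v-last : A v (g (fromℕ (suc (suc m)))) ≡ true
      v-last = trans (A-sym v _) (subst (λ x → A (g (fromℕ (suc (suc m)))) x ≡ true) g0≡v (cyclic-closing Adjacent cyc))
      pair : edge a c (g (fromℕ (suc (suc m)))) (g 1F) ≡ true × A (g (fromℕ (suc (suc m)))) (g 1F) ≡ false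
      pair = star-pair (g∈ _) (g∈ 1F) v-last v-first (λ eq → contradiction (g-injective eq) λ ())
      splice : ∀ m {g : Fin (suc (suc (suc m))) → Fin (suc k)} → Injective _≡_ _≡_ g → (∀ t → g t ∈ lift true M′) →
               g zero ≡ v → Cyclic Adjacent g → edge a c (g (fromℕ (suc (suc m)))) (g 1F) ≡ true × A (g (fromℕ (suc (suc m)))) (g 1F) ≡ false → ⊥
      splice zero    _ _ _ cyc (_ , A21≡false) = contradiction (trans (A-sym _ _) (cyclic-path Adjacent cyc 1F)) (λ A21 → true⇒≢false A21 A21≡false)
      splice (suc m) {g} g-injective g∈ g0≡v cyc (E-last , _) =
        forest (project-cycle (Fin.suc-injective ∘ g-injective) (λ t gt≡v → contradiction (g-injective (trans gt≡v (≡.sym g0≡v))) λ ())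
                 (g∈ ∘ suc) (λ j → A⇒A∪E (cyclic-path Adjacent cyc (suc j))) (E⇒A∪E E-last))

    star-forest : IsForestOn G (lift true M′)
    star-forest (m , f , f-injective , f∈ , path , closing) with any? (λ t → f t Fin.≟ v)
    ... | no  avoids      = forest (project-cycle f-injective (λ t ft≡v → avoids (t , ft≡v)) f∈ (A⇒A∪E ∘ path) (A⇒A∪E closing))
    ... | yes (t , ft≡v) =
      let σ , σ-injective , σ0≡t , cyc = rotate Adjacent (cyclic Adjacent {f = f} path closing) t
      in through-v m {f ∘ σ} (σ-injective ∘ f-injective) (f∈ ∘ σ) (trans (cong f σ0≡t) ft≡v) cyc

  forest-cut-lifts : ¬ Σ (Subset (suc k)) (ΨCut 𝔉 G) → ¬ Σ (Subset k) (ΨCut 𝔉 G′)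
  forest-cut-lifts no-cut (M′ , cut) with a′ ∈? M′ | c′ ∈? M′ | b′ ∈? M′ | d′ ∈? M′
  ... | no a∉  | _      | _      | _      = no-cut (_ , lift-ΨCut (hub-connects a′ a∉ hub-a) cut)
  ... | yes _  | no c∉  | _      | _      = no-cut (_ , lift-ΨCut (hub-connects c′ c∉ hub-c) cut)
  ... | yes a∈ | yes c∈ | yes b∈ | _      = no-cut (_ , lift-ΨCut (unique-connects λ x y vx vy x∉ y∉ → trans (only-d x vx x∉) (≡.sym (only-d y vy y∉))) cut)
    where
    only-d : ∀ x′ → A v (punchIn v x′) ≡ true → x′ ∉ M′ → x′ ≡ d′
    only-d x′ vx x∉ with around′ x′ vx
    ... | inj₁ refl               = contradiction a∈ x∉
    ... | inj₂ (inj₁ refl)        = contradiction b∈ x∉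
    ... | inj₂ (inj₂ (inj₁ refl)) = contradiction c∈ x∉
    ... | inj₂ (inj₂ (inj₂ x≡d)) = x≡d
  ... | yes a∈ | yes c∈ | no _   | yes d∈ = no-cut (_ , lift-ΨCut (unique-connects λ x y vx vy x∉ y∉ → trans (only-b x vx x∉) (≡.sym (only-b y vy y∉))) cut)
    where
    only-b : ∀ x′ → A v (punchIn v x′) ≡ true → x′ ∉ M′ → x′ ≡ b′
    only-b x′ vx x∉ with around′ x′ vx
    ... | inj₁ refl               = contradiction a∈ x∉
    ... | inj₂ (inj₁ x≡b)        = x≡b
    ... | inj₂ (inj₂ (inj₁ refl)) = contradiction c∈ x∉
    ... | inj₂ (inj₂ (inj₂ refl)) = contradiction d∈ x∉
  ... | yes a∈ | yes c∈ | no b∉  | no d∉  = no-cut (_ , lift-VertexCut (proj₁ cut) , star-forest (proj₂ cut) a∈ c∈ b∉ d∉)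

-- Classifying neighbourhoods on three and four vertices

FourCycle : Adj 4 → Set
FourCycle B = ∃₂ λ a b → ∃₂ λ c d → (∀ x → x ≡ a ⊎ x ≡ b ⊎ x ≡ c ⊎ x ≡ d) × a ≢ c ×
  B a b ≡ true × B b c ≡ true × B c d ≡ true × B d a ≡ true × B a c ≡ false

IsoTo : ∀ {m d} → Adj m → Adj d → Set
IsoTo {m} {d} T B = Σ (Fin m → Fin d) λ p → (∀ i j → p i ≡ p j → i ≡ j) × (∀ j → ∃ λ i → p i ≡ j) ×
  (∀ i j → B (p i) (p j) ≡ T i j)

-- The cases of the proof for the adjacency B of an enumerated neighbourhood, each with its certificate.
data Verdict : Class → ∀ {d} → Adj d → Set where
  clique       : ∀ {Ψ d} {B : Adj d} → IsClique B → Verdict Ψ B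
  clique-minus : ∀ {Ψ} {B : Adj 4} a c → a ≢ c → IsClique (B ∪ edge a c) → Verdict Ψ B
  local-class  : ∀ {Ψ d} {B : Adj d} → LocalClass Ψ B → Verdict Ψ B
  four-cycle   : ∀ {B} → FourCycle B → Verdict 𝔉 B
  iso₀         : ∀ {Ψ} {B : Adj 4} → IsoTo (adj T₀) B → Verdict Ψ B
  iso₁         : ∀ {Ψ} {B : Adj 4} → IsoTo (adj T₁) B → Verdict Ψ B

isTrue? : (b : Bool) → Dec (b ≡ true)
isTrue? b = b Bool.≟ true

clique? : ∀ {d} (B : Adj d) → Dec (IsClique B)
clique? B = all? λ i → all? λ j → ¬? (i Fin.≟ j) →-dec isTrue? (B i j)

localClass? : ∀ Ψ {d} (B : Adj d) → Dec (LocalClass Ψ B)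
localClass? 𝔉 B =
  (all? λ i → all? λ j → all? λ l → isTrue? (B i j) →-dec isTrue? (B j l) →-dec ¬? (isTrue? (B l i))) ×-dec
  (all? λ i → all? λ j → all? λ l → all? λ o → ¬? (i Fin.≟ l) →-dec ¬? (j Fin.≟ o) →-dec
     isTrue? (B i j) →-dec isTrue? (B j l) →-dec isTrue? (B l o) →-dec ¬? (isTrue? (B o i)))
localClass? 𝔅 B = anySubset? λ S → all? λ i → all? λ j → isTrue? (B i j) →-dec ¬? (lookup S i Bool.≟ lookup S j)

fourCycle? : (B : Adj 4) → Dec (FourCycle B)
fourCycle? B = any? λ a → any? λ b → any? λ c → any? λ d →
  (all? λ x → x Fin.≟ a ⊎-dec x Fin.≟ b ⊎-dec x Fin.≟ c ⊎-dec x Fin.≟ d) ×-dec ¬? (a Fin.≟ c) ×-dec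
  isTrue? (B a b) ×-dec isTrue? (B b c) ×-dec isTrue? (B c d) ×-dec isTrue? (B d a) ×-dec B a c Bool.≟ false

iso? : ∀ (T B : Adj 4) → Maybe (IsoTo T B)
iso? T B = Maybe.map (λ (a , b , c , d , h) → lookup (a ∷ b ∷ c ∷ d ∷ []) , h) (dec⇒maybe (any? λ a → any? λ b → any? λ c → any? λ d →
  let p = lookup (a ∷ b ∷ c ∷ d ∷ []) in
  (all? λ i → all? λ j → p i Fin.≟ p j →-dec i Fin.≟ j) ×-dec (all? λ j → any? λ i → p i Fin.≟ j) ×-dec
  (all? λ i → all? λ j → B (p i) (p j) Bool.≟ T i j)))

verdict₃? : ∀ Ψ (B : Adj 3) → Maybe (Verdict Ψ B)
verdict₃? Ψ B = Maybe.map clique (dec⇒maybe (clique? B)) <∣> Maybe.map local-class (dec⇒maybe (localClass? Ψ B))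

verdict₄? : ∀ Ψ (B : Adj 4) → Maybe (Verdict Ψ B)
verdict₄? Ψ B =
  Maybe.map (λ (a , c , a≢c , cl) → clique-minus a c a≢c cl)
    (dec⇒maybe (any? λ a → any? λ c → ¬? (a Fin.≟ c) ×-dec clique? (B ∪ edge a c)))
  <∣> Maybe.map local-class (dec⇒maybe (localClass? Ψ B))
  <∣> fourCycle-verdict? Ψ
  <∣> Maybe.map iso₀ (iso? adjT0 B)
  <∣> Maybe.map iso₁ (iso? adjT1 B)
  where
  fourCycle-verdict? : ∀ Ψ → Maybe (Verdict Ψ B)
  fourCycle-verdict? 𝔉 = Maybe.map four-cycle (dec⇒maybe (fourCycle? B))
  fourCycle-verdict? 𝔅 = nothing

config₃ : Bool → Bool → Bool → Adj 3
config₃ x₀₁ x₀₂ x₁₂ 0F 1F = x₀₁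
config₃ x₀₁ x₀₂ x₁₂ 0F 2F = x₀₂
config₃ x₀₁ x₀₂ x₁₂ 1F 2F = x₁₂
config₃ x₀₁ x₀₂ x₁₂ 1F 0F = x₀₁
config₃ x₀₁ x₀₂ x₁₂ 2F 0F = x₀₂
config₃ x₀₁ x₀₂ x₁₂ 2F 1F = x₁₂
config₃ x₀₁ x₀₂ x₁₂ _  _  = false

config₄ : Bool → Bool → Bool → Bool → Bool → Bool → Adj 4
config₄ x₀₁ x₀₂ x₀₃ x₁₂ x₁₃ x₂₃ 0F 1F = x₀₁
config₄ x₀₁ x₀₂ x₀₃ x₁₂ x₁₃ x₂₃ 0F 2F = x₀₂
config₄ x₀₁ x₀₂ x₀₃ x₁₂ x₁₃ x₂₃ 0F 3F = x₀₃
config₄ x₀₁ x₀₂ x₀₃ x₁₂ x₁₃ x₂₃ 1F 2F = x₁₂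
config₄ x₀₁ x₀₂ x₀₃ x₁₂ x₁₃ x₂₃ 1F 3F = x₁₃
config₄ x₀₁ x₀₂ x₀₃ x₁₂ x₁₃ x₂₃ 2F 3F = x₂₃
config₄ x₀₁ x₀₂ x₀₃ x₁₂ x₁₃ x₂₃ 1F 0F = x₀₁
config₄ x₀₁ x₀₂ x₀₃ x₁₂ x₁₃ x₂₃ 2F 0F = x₀₂
config₄ x₀₁ x₀₂ x₀₃ x₁₂ x₁₃ x₂₃ 3F 0F = x₀₃
config₄ x₀₁ x₀₂ x₀₃ x₁₂ x₁₃ x₂₃ 2F 1F = x₁₂
config₄ x₀₁ x₀₂ x₀₃ x₁₂ x₁₃ x₂₃ 3F 1F = x₁₃
config₄ x₀₁ x₀₂ x₀₃ x₁₂ x₁₃ x₂₃ 3F 2F = x₂₃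
config₄ x₀₁ x₀₂ x₀₃ x₁₂ x₁₃ x₂₃ _  _  = false

config₃-correct : ∀ {B : Adj 3} → Symmetric B → Irreflexive B → ∀ i j → B i j ≡ config₃ (B 0F 1F) (B 0F 2F) (B 1F 2F) i j
config₃-correct B-sym B-irr 0F 0F = B-irr 0F
config₃-correct B-sym B-irr 0F 1F = refl
config₃-correct B-sym B-irr 0F 2F = refl
config₃-correct B-sym B-irr 1F 0F = B-sym 1F 0F
config₃-correct B-sym B-irr 1F 1F = B-irr 1F
config₃-correct B-sym B-irr 1F 2F = refl
config₃-correct B-sym B-irr 2F 0F = B-sym 2F 0F
config₃-correct B-sym B-irr 2F 1F = B-sym 2F 1F
config₃-correct B-sym B-irr 2F 2F = B-irr 2F

config₄-correct : ∀ {B : Adj 4} → Symmetric B → Irreflexive B →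
  ∀ i j → B i j ≡ config₄ (B 0F 1F) (B 0F 2F) (B 0F 3F) (B 1F 2F) (B 1F 3F) (B 2F 3F) i j
config₄-correct B-sym B-irr 0F 0F = B-irr 0F
config₄-correct B-sym B-irr 0F 1F = refl
config₄-correct B-sym B-irr 0F 2F = refl
config₄-correct B-sym B-irr 0F 3F = refl
config₄-correct B-sym B-irr 1F 0F = B-sym 1F 0F
config₄-correct B-sym B-irr 1F 1F = B-irr 1F
config₄-correct B-sym B-irr 1F 2F = refl
config₄-correct B-sym B-irr 1F 3F = refl
config₄-correct B-sym B-irr 2F 0F = B-sym 2F 0F
config₄-correct B-sym B-irr 2F 1F = B-sym 2F 1F
config₄-correct B-sym B-irr 2F 2F = B-irr 2F
config₄-correct B-sym B-irr 2F 3F = refl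
config₄-correct B-sym B-irr 3F 0F = B-sym 3F 0F
config₄-correct B-sym B-irr 3F 1F = B-sym 3F 1F
config₄-correct B-sym B-irr 3F 2F = B-sym 3F 2F
config₄-correct B-sym B-irr 3F 3F = B-irr 3F

all-Bool? : ∀ {P : Bool → Set} → (∀ b → Dec (P b)) → Dec (∀ b → P b)
all-Bool? P? = map′ (λ (f , t) → λ { false → f ; true → t }) (λ h → h false , h true) (P? false ×-dec P? true)

-- Decided by evaluating the search on all 2³ and 2⁶ configurations.
exhaustive₃ : ∀ Ψ x₀₁ x₀₂ x₁₂ → T (is-just (verdict₃? Ψ (config₃ x₀₁ x₀₂ x₁₂)))
exhaustive₃ 𝔉 = from-yes (all-Bool? λ x₀₁ → all-Bool? λ x₀₂ → all-Bool? λ x₁₂ → T? (is-just (verdict₃? 𝔉 (config₃ x₀₁ x₀₂ x₁₂))))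
exhaustive₃ 𝔅 = from-yes (all-Bool? λ x₀₁ → all-Bool? λ x₀₂ → all-Bool? λ x₁₂ → T? (is-just (verdict₃? 𝔅 (config₃ x₀₁ x₀₂ x₁₂))))

exhaustive₄ : ∀ Ψ x₀₁ x₀₂ x₀₃ x₁₂ x₁₃ x₂₃ → T (is-just (verdict₄? Ψ (config₄ x₀₁ x₀₂ x₀₃ x₁₂ x₁₃ x₂₃)))
exhaustive₄ 𝔉 = from-yes (all-Bool? λ x₀₁ → all-Bool? λ x₀₂ → all-Bool? λ x₀₃ → all-Bool? λ x₁₂ → all-Bool? λ x₁₃ → all-Bool? λ x₂₃ →
  T? (is-just (verdict₄? 𝔉 (config₄ x₀₁ x₀₂ x₀₃ x₁₂ x₁₃ x₂₃))))
exhaustive₄ 𝔅 = from-yes (all-Bool? λ x₀₁ → all-Bool? λ x₀₂ → all-Bool? λ x₀₃ → all-Bool? λ x₁₂ → all-Bool? λ x₁₃ → all-Bool? λ x₂₃ →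
  T? (is-just (verdict₄? 𝔅 (config₄ x₀₁ x₀₂ x₀₃ x₁₂ x₁₃ x₂₃))))

classify₃ : ∀ Ψ {B : Adj 3} → Symmetric B → Irreflexive B → ∃ λ B′ → (∀ i j → B i j ≡ B′ i j) × Verdict Ψ B′
classify₃ Ψ {B} B-sym B-irr =
  _ , config₃-correct B-sym B-irr , to-witness-T (verdict₃? Ψ (config₃ x₀₁ x₀₂ x₁₂)) (exhaustive₃ Ψ x₀₁ x₀₂ x₁₂)
  where
  x₀₁ x₀₂ x₁₂ : Bool
  x₀₁ = B 0F 1F
  x₀₂ = B 0F 2F
  x₁₂ = B 1F 2F

classify₄ : ∀ Ψ {B : Adj 4} → Symmetric B → Irreflexive B → ∃ λ B′ → (∀ i j → B i j ≡ B′ i j) × Verdict Ψ B′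
classify₄ Ψ {B} B-sym B-irr =
  _ , config₄-correct B-sym B-irr ,
  to-witness-T (verdict₄? Ψ (config₄ x₀₁ x₀₂ x₀₃ x₁₂ x₁₃ x₂₃)) (exhaustive₄ Ψ x₀₁ x₀₂ x₀₃ x₁₂ x₁₃ x₂₃)
  where
  x₀₁ x₀₂ x₀₃ x₁₂ x₁₃ x₂₃ : Bool
  x₀₁ = B 0F 1F
  x₀₂ = B 0F 2F
  x₀₃ = B 0F 3F
  x₁₂ = B 1F 2F
  x₁₃ = B 1F 3F
  x₂₃ = B 2F 3F

-- Minimal graphs

clique-or-non-edge : ∀ {m} (A : Adj m) → IsClique A ⊎ ∃₂ λ x y → y ≢ x × A x y ≡ false
clique-or-non-edge A with any? (λ x → any? (λ y → ¬? (y Fin.≟ x) ×-dec A x y Bool.≟ false))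
... | yes (x , y , y≢x , xy) = inj₂ (x , y , y≢x , xy)
... | no  none               = inj₁ adjacent
  where
  adjacent : IsClique A
  adjacent x y x≢y with A x y in xy
  ... | true  = refl
  ... | false = contradiction (x , y , x≢y ∘ ≡.sym , xy) none

==-injective : ∀ {m d} {g : Fin d → Fin m} → Injective _≡_ _≡_ g → ∀ i j → (g i == g j) ≡ (i == j)
==-injective {g = g} g-injective i j = does-⇔ (mk⇔ g-injective (cong g)) (g i Fin.≟ g j) (i Fin.≟ j)

edge-image : ∀ {m d} {g : Fin d → Fin m} → Injective _≡_ _≡_ g → ∀ a c i j → edge (g a) (g c) (g i) (g j) ≡ edge a c i j
edge-image g-injective a c i j rewrite ==-injective g-injective i a | ==-injective g-injective j c
                                     | ==-injective g-injective i c | ==-injective g-injective j a = refl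

module Extremal (Ψ : Class) {α β : ℚ} (α≤3 : α ≤ℚ toℚ 3) (4α-β≡6 : toℚ 4 * α - β ≡ toℚ 6)
                {k} (A : Adj (suc k)) (A-sym : Symmetric A) (A-irr : Irreflexive A) where

  G : Graph
  G = record { n = suc k ; adj = A ; sym = A-sym ; irrefl = A-irr }

  module _ (G∈𝒢 : In𝒢 Ψ α β G) where

    no-Ψ-cut : ¬ Σ (Subset (suc k)) (ΨCut Ψ G)
    no-Ψ-cut = proj₂ (proj₂ (proj₁ G∈𝒢))

    q-pos : 0ℚ < q α β G
    q-pos = proj₁ (proj₂ (proj₁ G∈𝒢))

    deletion-has-Ψ-cut : ∀ v {E} (E-sym : Symmetric E) (E-irr : Irreflexive E) → 5 ≤ n G → edges E + 3 ≤ deg G v →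
                         ¬ ¬ Σ (Subset k) (ΨCut Ψ (VertexDeletion.G′ A A-sym A-irr v E E-sym E-irr))
    deletion-has-Ψ-cut v E-sym E-irr 5≤n E+3≤deg no-cut′ =
      ℕ.n≮n k (proj₂ G∈𝒢 G′ (ℕ.s≤s⁻¹ 5≤n , q-G′-pos α≤3 E+3≤deg q-pos , no-cut′))
      where open VertexDeletion A A-sym A-irr v _ E-sym E-irr

    degree-with-non-neighbour : ∀ {x y} → y ≢ x → A x y ≡ false → suc (deg G x) ℕ.< suc k
    degree-with-non-neighbour {x} {y} y≢x xy = s≤s (subst (ℕ._< k) (≡.sym (count-removeVertex {A = A} A-irr x))
      (false⇒count< (A x ∘ punchIn x) (punchOut x≢y) (trans (cong (A x) (Fin.punchIn-punchOut x≢y)) xy)))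
      where
      x≢y : x ≢ y
      x≢y = y≢x ∘ ≡.sym

    N-notInClass : ∀ v → suc (deg G v) ℕ.< suc k → ¬ InClassOn Ψ G (N G v)
    N-notInClass v small inΨ =
      let w , vw≡false = count<⇒false (A v ∘ punchIn v) (subst (ℕ._< k) (count-removeVertex {A = A} A-irr v) (ℕ.s≤s⁻¹ small))
      in no-Ψ-cut (N G v , N-isVertexCut G (Fin.punchInᵢ≢i v w) vw≡false , inΨ)

    module Neighbourhood (v : Fin (suc k)) {d} (deg≡d : deg G v ≡ d) where

      open Enumeration (subst (Enumeration (A v)) deg≡d (enumerate (A v))) public

      local : Adj d
      local i j = A (at i) (at j)

      local-sym : Symmetric local
      local-sym i j = A-sym (at i) (at j)

      local-irr : Irreflexive local
      local-irr i = A-irr (at i)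

      onto-N : ∀ u → u ∈ N G v → ∃ λ i → at i ≡ u
      onto-N u u∈N = onto u (∈N⇒adj G u∈N)

      completion-impossible : ∀ {E} (E-sym : Symmetric E) (E-irr : Irreflexive E) → 5 ≤ n G → edges E + 3 ≤ d →
                              (∀ i j → i ≢ j → (A ∪ E) (at i) (at j) ≡ true) → ⊥
      completion-impossible {E} E-sym E-irr 5≤n E+3≤d complete =
        deletion-has-Ψ-cut v E-sym E-irr 5≤n (subst (edges E + 3 ≤_) (≡.sym deg≡d) E+3≤d)
          λ (M′ , cut) → no-Ψ-cut (_ , lift-ΨCut (clique-connects adjacent) cut)
        where
        open VertexDeletion A A-sym A-irr v E E-sym E-irr
        adjacent : ∀ x y → A v (punchIn v x) ≡ true → A v (punchIn v y) ≡ true → x ≡ y ⊎ adj G′ x y ≡ true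
        adjacent x y vx vy =
          let i , i↦x = onto _ vx ; j , j↦y = onto _ vy
          in Sum.map (λ i≡j → Fin.punchIn-injective v x y (trans (≡.sym i↦x) (trans (cong at i≡j) j↦y)))
                     (λ i≢j → subst₂ (λ p q → (A ∪ E) p q ≡ true) i↦x j↦y (complete i j i≢j))
                     (toSum (i Fin.≟ j))

      clique-impossible : ∀ {B} → (∀ i j → local i j ≡ B i j) → 3 ≤ d → 5 ≤ n G → ¬ IsClique B
      clique-impossible local≡B 3≤d 5≤n B-clique =
        completion-impossible {∅} (λ _ _ → refl) (λ _ → refl) 5≤n (subst (λ x → x + 3 ≤ d) (≡.sym (edges-∅ {suc k})) 3≤d)
          λ i j i≢j → ∪-introˡ {A = A} {B = ∅} (trans (local≡B i j) (B-clique i j i≢j))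

      localClass-impossible : ∀ {B} → (∀ i j → local i j ≡ B i j) → d ≤ 4 → suc d ℕ.< suc k → ¬ LocalClass Ψ B
      localClass-impossible local≡B d≤4 small cls =
        N-notInClass v (subst (λ x → suc x ℕ.< suc k) (≡.sym deg≡d) small) (localClass-lifts G injective onto-N local≡B Ψ d≤4 cls)

      induced-iso : ∀ T {B} → (∀ i j → local i j ≡ B i j) → IsoTo (adj T) B → InducedIso T G (N G v)
      induced-iso T local≡B (p , p-injective , p-onto , p-adj) = at ∘ p , injective′ , (λ i → adj⇒∈N G (member (p i))) , cover , adj′
        where
        injective′ : Injective _≡_ _≡_ (at ∘ p)
        injective′ eq = p-injective _ _ (injective eq)
        cover : ∀ x → x ∈ N G v → Σ (Fin (n T)) λ i → at (p i) ≡ x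
        cover x x∈N = let j , j↦x = onto-N x x∈N ; i , i↦j = p-onto j in i , trans (cong at i↦j) j↦x
        adj′ : ∀ i j → A (at (p i)) (at (p j)) ≡ adj T i j
        adj′ i j = trans (local≡B (p i) (p j)) (p-adj i j)

    small-degree-impossible : ∀ v → deg G v ≤ 2 → suc (deg G v) ℕ.< suc k → ⊥
    small-degree-impossible v deg≤2 small =
      localClass-impossible (λ _ _ → refl) (ℕ.≤-trans deg≤2 (ℕ.m≤m+n 2 2)) small (localClass-≤2 Ψ local-irr deg≤2)
      where open Neighbourhood v refl

    order≮5 : ¬ n G ℕ.< 5
    order≮5 n<5 = Sum.[ K₄-impossible , non-edge-impossible ] (clique-or-non-edge A)
      where
      n≡4 : n G ≡ 4
      n≡4 = ℕ.≤-antisym (ℕ.s≤s⁻¹ n<5) (proj₁ (proj₁ G∈𝒢))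
      K₄-impossible : IsClique A → ⊥
      K₄-impossible complete =
        q-K₄-nonpos {α} {β} G 4α-β≡6 n≡4 (trans (edges-complete A-sym A-irr complete) (cong (_C 2) n≡4)) q-pos
      non-edge-impossible : (∃₂ λ x y → y ≢ x × A x y ≡ false) → ⊥
      non-edge-impossible (x , y , y≢x , xy) =
        small-degree-impossible x (ℕ.s≤s⁻¹ (ℕ.s≤s⁻¹ (ℕ.≤-trans small (ℕ.s≤s⁻¹ n<5)))) small
        where
        small : suc (deg G x) ℕ.< suc k
        small = degree-with-non-neighbour y≢x xy

    order≥5 : 5 ≤ n G
    order≥5 = ℕ.≮⇒≥ order≮5

    degree≢3 : ∀ v → deg G v ≢ 3
    degree≢3 v deg≡3 = let _ , local≡B , verdict = classify₃ Ψ local-sym local-irr in impossible local≡B verdict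
      where
      open Neighbourhood v deg≡3
      impossible : ∀ {B} → (∀ i j → local i j ≡ B i j) → Verdict Ψ B → ⊥
      impossible local≡B (clique B-clique) = clique-impossible local≡B ℕ.≤-refl order≥5 B-clique
      impossible local≡B (local-class cls)  = localClass-impossible local≡B (ℕ.m≤m+n 3 1) order≥5 cls

    degree≥4 : ∀ v → 4 ≤ deg G v
    degree≥4 v = at-least-4 (deg G v) refl
      where
      small : deg G v ≤ 2 → ⊥
      small deg≤2 = small-degree-impossible v deg≤2 (ℕ.≤-trans (s≤s (s≤s deg≤2)) (ℕ.<⇒≤ order≥5))
      at-least-4 : ∀ d → deg G v ≡ d → 4 ≤ d
      at-least-4 0 deg≡ = ⊥-elim (small (subst (_≤ 2) (≡.sym deg≡) z≤n))
      at-least-4 1 deg≡ = ⊥-elim (small (subst (_≤ 2) (≡.sym deg≡) (s≤s z≤n)))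
      at-least-4 2 deg≡ = ⊥-elim (small (subst (_≤ 2) (≡.sym deg≡) ℕ.≤-refl))
      at-least-4 3 deg≡ = ⊥-elim (degree≢3 v deg≡)
      at-least-4 (suc (suc (suc (suc d)))) _ = s≤s (s≤s (s≤s (s≤s z≤n)))

    order≮6 : ¬ n G ℕ.< 6
    order≮6 n<6 = q-K₅-nonpos {α} {β} G α≤3 4α-β≡6 n≡5 (trans (edges-complete A-sym A-irr complete) (cong (_C 2) n≡5)) q-pos
      where
      n≡5 : n G ≡ 5
      n≡5 = ℕ.≤-antisym (ℕ.s≤s⁻¹ n<6) order≥5
      complete : IsClique A
      complete x y x≢y = trans (cong (A x) (≡.sym (Fin.punchIn-punchOut x≢y)))
        (count-full (A x ∘ punchIn x) (subst (_≤ count (A x ∘ punchIn x)) (≡.sym (ℕ.suc-injective n≡5))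
          (subst (4 ≤_) (count-removeVertex {A = A} A-irr x) (degree≥4 x))) (punchOut x≢y))

    order≥6 : 6 ≤ n G
    order≥6 = ℕ.≮⇒≥ order≮6

    degree4-shape : ∀ v → deg G v ≡ 4 → InducedIso T₀ G (N G v) ⊎ InducedIso T₁ G (N G v)
    degree4-shape v deg≡4 = let _ , local≡B , verdict = classify₄ Ψ local-sym local-irr in shape local≡B verdict
      where
      open Neighbourhood v deg≡4
      shape : ∀ {B} → (∀ i j → local i j ≡ B i j) → Verdict Ψ B → InducedIso T₀ G (N G v) ⊎ InducedIso T₁ G (N G v)
      shape local≡B (clique B-clique) = ⊥-elim (clique-impossible local≡B (ℕ.m≤n+m 3 1) order≥5 B-clique)
      shape local≡B (clique-minus a c a≢c B∪ac-clique) = ⊥-elim $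
        completion-impossible (edge-sym (at a) (at c)) (edge-irr (a≢c ∘ injective)) order≥5
          (subst (λ x → x + 3 ≤ 4) (≡.sym (edges-edge (a≢c ∘ injective))) ℕ.≤-refl)
          λ i j i≢j → trans (cong₂ _∨_ (local≡B i j) (edge-image injective a c i j)) (B∪ac-clique i j i≢j)
      shape local≡B (local-class cls) = ⊥-elim (localClass-impossible local≡B ℕ.≤-refl order≥6 cls)
      shape local≡B (four-cycle (a , b , c , d , cover , a≢c , ab , bc , cd , da , ac)) = ⊥-elim $
        deletion-has-Ψ-cut v (edge-sym (at a) (at c)) (edge-irr (a≢c ∘ injective)) order≥5
          (subst₂ (λ x y → x + 3 ≤ y) (≡.sym (edges-edge (a≢c ∘ injective))) (≡.sym deg≡4) ℕ.≤-refl) (forest-cut-lifts no-Ψ-cut)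
        where
        via : ∀ {x i j} → at i ≡ x → i ≡ j → x ≡ at j
        via i↦x refl = ≡.sym i↦x
        around : ∀ x → A v x ≡ true → x ≡ at a ⊎ x ≡ at b ⊎ x ≡ at c ⊎ x ≡ at d
        around x vx = let i , i↦x = onto x vx in Sum.map (via i↦x) (Sum.map (via i↦x) (Sum.map (via i↦x) (via i↦x))) (cover i)
        open SquareNeighbourhood A A-sym A-irr (a≢c ∘ injective) around (member a) (member b) (member c) (member d)
          (trans (local≡B a b) ab) (trans (local≡B b c) bc) (trans (local≡B c d) cd) (trans (local≡B d a) da) (trans (local≡B a c) ac)
      shape local≡B (iso₀ iso) = inj₁ (induced-iso T₀ local≡B iso)
      shape local≡B (iso₁ iso) = inj₂ (induced-iso T₁ local≡B iso)

corollary1 : (Ψ : Class) (α β : ℚ) →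
    (+ 2 / 1) < α → α ≤ℚ (+ 3 / 1) → (+ 4 / 1) * α - β ≡ + 6 / 1 →
    (G : Graph) → In𝒢 Ψ α β G →
    (∀ (v : Fin (n G)) → 4 ≤ deg G v) ×
    (∀ (v : Fin (n G)) → deg G v ≡ 4 →
      InducedIso T₀ G (N G v) ⊎ InducedIso T₁ G (N G v))
corollary1 Ψ α β _ α≤3 4α-β≡6 record { n = zero } ((() , _) , _)
corollary1 Ψ α β _ α≤3 4α-β≡6 record { n = suc k ; adj = A ; sym = A-sym ; irrefl = A-irr } G∈𝒢 =
  degree≥4 G∈𝒢 , degree4-shape G∈𝒢
  where open Extremal Ψ α≤3 4α-β≡6 A A-sym A-irr
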